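{- For integers $m,n\geq 0$ and $q\geq 0$, \[ \bigl|\mathsf{Del}_{m,n}(q)\bigr| = H_{m,n}(q+1,0)=\sum_{a=0}^{\min\{m,n\}}\binom{m}{a}\binom{n}{a}(q+1)^a, \] where $H_{m,n}(q+1,0)$ is evaluated with the convention $0^0=1$.
   Context: A $q$-Delannoy path (for an integer $q\geq0$) is a lattice path from $(0,0)$ to $(m,n)$ using steps $(1,0)$, $(0,1)$, and diagonal steps $(1,1)$ each of which carries one of $q$ colors; $\mathsf{Del}_{m,n}(q)$ is the set of such paths. Let $X=\{x_1,\dots,x_m\}$, $Y=\{y_1,\dots,y_n\}$. A shuffle word is a word over $X\cup Y$ without repeated letters in which $x_i$ precedes $x_j$ and $y_i$ precedes $y_j$ whenever both occur and $i<j$. The bubble lattice orders shuffle words by the reflexive–transitive closure of: (indel) delete a letter of $X$ or insert a letter of $Y$; (transposition) replace a consecutive factor $xy$ ($x\in X,y\in Y$) by $yx$. $\mathsf{in}(\mathbf u)$ is the number of lower covers of $\mathbf u$, $\mathsf{in}_{\mathrm{indel}}(\mathbf u)$ the number of those differing from $\mathbf u$ by an indel, and $H_{m,n}(q,t)=\sum_{\mathbf u}q^{\mathsf{in}(\mathbf u)}t^{\mathsf{in}_{\mathrm{indel}}(\mathbf u)}$ (sum over all shuffle words). -}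

module Defs where

open import Data.Nat using (ℕ; zero; suc; _+_; _*_; _^_; _⊓_)
open import Data.Nat.ListAction using (sum)
open import Data.Nat.Combinatorics using (_C_)
open import Data.Fin using (Fin)
import Data.Fin as F
import Data.Fin.Properties as FP
open import Data.List using (List; []; _∷_; _++_; map; concatMap; filter; upTo; allFin; length)
open import Data.List.Relation.Unary.AllPairs using (AllPairs; allPairs?)
open import Data.List.Relation.Unary.Unique.Propositional using (Unique)
open import Data.List.Membership.Propositional using (_∈_)
open import Data.Product using (Σ; _×_; _,_)
open import Data.Unit using (⊤; tt)
open import Data.Empty using (⊥)
open import Function.Bundles using (_⇔_)
open import Relation.Nullary using (¬_; Dec; yes; no; ¬?)
open import Relation.Nullary.Decidable using (_×-dec_)
open import Relation.Binary.PropositionalEquality using (_≡_; _≢_; refl; cong)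
open import Relation.Binary.Definitions using (DecidableEquality)
open import Relation.Binary.Construct.Closure.ReflexiveTransitive using (Star)

-- q-Delannoy paths from (0,0) to (m,n): steps E=(1,0), N=(0,1) and
-- diagonal steps D=(1,1) carrying one of q colours (Fin q).
-- A path is built by appending its last step.

data Del (q : ℕ) : ℕ → ℕ → Set where
  start : Del q 0 0
  east  : ∀ {m n} → Del q m n → Del q (suc m) n
  north : ∀ {m n} → Del q m n → Del q m (suc n)
  diag  : ∀ {m n} → Fin q → Del q m n → Del q (suc m) (suc n)

-- Σ_{a=0}^{min(m,n)} C(m,a) C(n,a) Q^a   (with 0^0 = 1, as for Agda's _^_)
binomSum : ℕ → ℕ → ℕ → ℕ
binomSum m n Q = sum (map (λ a → (m C a) * (n C a) * Q ^ a) (upTo (suc (m ⊓ n))))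

data Letter (m n : ℕ) : Set where
  x : Fin m → Letter m n
  y : Fin n → Letter m n

_≟L_ : ∀ {m n} → DecidableEquality (Letter m n)
x i ≟L x j with i F.≟ j
... | yes refl = yes refl
... | no ne = no λ { refl → ne refl }
x i ≟L y j = no λ ()
y i ≟L x j = no λ ()
y i ≟L y j with i F.≟ j
... | yes refl = yes refl
... | no ne = no λ { refl → ne refl }

Word : ℕ → ℕ → Set
Word m n = List (Letter m n)

-- Precedence condition for an earlier letter a and a later letter b:
-- if x_j occurs before x_i then not (i < j); likewise for Y.
Prec : ∀ {m n} → Letter m n → Letter m n → Set
Prec (x j) (x i) = ¬ (i F.< j)
Prec (y j) (y i) = ¬ (i F.< j)
Prec (x _) (y _) = ⊤
Prec (y _) (x _) = ⊤

prec? : ∀ {m n} (a b : Letter m n) → Dec (Prec a b)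
prec? (x j) (x i) = ¬? (i F.<? j)
prec? (y j) (y i) = ¬? (i F.<? j)
prec? (x _) (y _) = yes tt
prec? (y _) (x _) = yes tt

IsShuffle : ∀ {m n} → Word m n → Set
IsShuffle w = Unique w × AllPairs Prec w

isShuffle? : ∀ {m n} (w : Word m n) → Dec (IsShuffle w)
isShuffle? w = allPairs? (λ a b → ¬? (a ≟L b)) w ×-dec allPairs? prec? w

allLetters : ∀ {m n} → List (Letter m n)
allLetters {m} {n} = map x (allFin m) ++ map y (allFin n)

wordsOfLength : ∀ {m n} → ℕ → List (Word m n)
wordsOfLength zero    = [] ∷ []
wordsOfLength (suc k) = concatMap (λ a → map (a ∷_) (wordsOfLength k)) allLetters

-- A shuffle word has no repeated letters, hence length ≤ m + n;
-- so this is the list of all shuffle words, each exactly once.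
shuffleWords : ∀ m n → List (Word m n)
shuffleWords m n =
  filter isShuffle? (concatMap wordsOfLength (upTo (suc (m + n))))

-- Bubble lattice.  Elementary moves w ⟶ v (v is "higher"):
--   delete a letter of X, insert a letter of Y, or xy ↦ yx.

data Indel {m n} : Word m n → Word m n → Set where
  delX : ∀ p s i → Indel (p ++ x i ∷ s) (p ++ s)
  insY : ∀ p s j → Indel (p ++ s) (p ++ y j ∷ s)

data Move {m n} : Word m n → Word m n → Set where
  indel : ∀ {w v} → Indel w v → Move w v
  swap  : ∀ p s i j → Move (p ++ x i ∷ y j ∷ s) (p ++ y j ∷ x i ∷ s)

Step : ∀ {m n} → Word m n → Word m n → Set
Step w v = IsShuffle w × IsShuffle v × Move w v

_≤B_ : ∀ {m n} → Word m n → Word m n → Set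
w ≤B v = Star Step w v

_<B_ : ∀ {m n} → Word m n → Word m n → Set
w <B v = w ≤B v × w ≢ v

_⋖_ : ∀ {m n} → Word m n → Word m n → Set
w ⋖ u = w <B u × (∀ z → IsShuffle z → w <B z → z <B u → ⊥)

LowerCover : ∀ {m n} → Word m n → Word m n → Set
LowerCover u w = IsShuffle w × w ⋖ u

IndelLowerCover : ∀ {m n} → Word m n → Word m n → Set
IndelLowerCover u w = LowerCover u w × Indel w u

-- "exactly k words satisfy P": a duplicate-free list of length k
-- whose members are exactly the words satisfying P.
CountIs : ∀ {m n} → (Word m n → Set) → ℕ → Set
CountIs {m} {n} P k =
  Σ (List (Word m n)) λ L → Unique L × (∀ w → (w ∈ L) ⇔ P w) × length L ≡ k

-- H_{m,n}(Q,T) = Σ_u Q^{in(u)} T^{in_indel(u)}, given the functions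
-- inC = in and inI = in_indel.
H : ∀ m n → (inC inI : Word m n → ℕ) → ℕ → ℕ → ℕ
H m n inC inI Q T = sum (map (λ u → Q ^ inC u * T ^ inI u) (shuffleWords m n))

-- Splitting a Delannoy path at its last step (east, north, or a diagonal in one of q colours)
-- gives D(m+1,n+1) = D(m,n+1) + D(m+1,n) + q·D(m,n), and Pascal's rule shows that
-- Σ_a C(m,a) C(n,a) (q+1)^a obeys the same recurrence.
--
-- At t = 0 only the shuffle words without indel lower covers survive in H. These are the words
-- that contain every x and in which every y is immediately followed by an x; any other shuffle
-- word has an indel lower cover (add a missing x at its place, or drop a y not followed by an x).
-- The lower covers of such a word are exactly its swaps yx ↦ xy, one per letter y, so a word
-- with a letters y contributes (q+1)^a, and building these words from left to right shows that
-- their weighted count is again the Delannoy number. That a single move is a cover is certified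
-- by two ranks that strictly increase along moves: one goes up by exactly one at every swap, the
-- other by exactly one at the indels used above.

module Submission where

open import Defs

open import Data.Bool using (Bool; true; false; if_then_else_)
open import Data.Bool.Properties using (T-≡)
open import Data.Empty using (⊥; ⊥-elim)
open import Data.Fin using (Fin)
import Data.Fin as F
import Data.Fin.Properties as FP
open import Data.List using (List; []; _∷_; _++_; [_]; map; length; applyUpTo; allFin; upTo; concatMap; filter)
import Data.List.Properties as LP
open import Data.List.Membership.Propositional using (_∈_; _∉_)
import Data.List.Membership.DecPropositional as DecMembership
open import Data.List.Membership.Propositional.Properties
  using (∈-++⁺ʳ; ∈-++⁺ˡ; ∈-++⁻; ∈-map⁺; ∈-map⁻; ∈-allFin; ∈-concat⁺′; ∈-concat⁻′;
         ∈-filter⁺; ∈-filter⁻; ∈-upTo⁺)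
open import Data.List.Membership.Propositional.Properties.WithK using (unique∧set⇒bag)
open import Data.List.Relation.Binary.BagAndSetEquality using (∼bag⇒↭)
open import Data.List.Relation.Binary.Permutation.Propositional using (_↭_)
import Data.List.Relation.Binary.Permutation.Propositional.Properties as Perm
open import Data.List.Relation.Binary.Sublist.Propositional using (_⊆_; []; _∷_; _∷ʳ_)
open import Data.List.Relation.Binary.Sublist.Propositional.Properties
  using ([]⊆-universal; All-resp-⊆; length-mono-≤)
open import Data.List.Relation.Unary.All as All using (All; []; _∷_)
import Data.List.Relation.Unary.All.Properties as AllP
open import Data.List.Relation.Unary.AllPairs as AllPairs using (AllPairs; []; _∷_)
import Data.List.Relation.Unary.AllPairs.Properties as APP
open import Data.List.Relation.Unary.Any using (here; there)
open import Data.List.Relation.Unary.Unique.Propositional using (Unique)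
import Data.List.Relation.Unary.Unique.Propositional.Properties as UP
open import Data.Maybe using (Maybe; just; nothing)
open import Data.Nat using (ℕ; zero; suc; _+_; _*_; _^_; _⊓_; _≤_; _<_; _≤ᵇ_; z≤n; s≤s)
open import Data.Nat.Combinatorics using (_C_; nCk+nC[k+1]≡[n+1]C[k+1])
open import Data.Nat.Combinatorics.Specification using (k>n⇒nCk≡0)
open import Data.Nat.ListAction using (sum)
open import Data.Nat.ListAction.Properties using (sum-++; sum-↭)
open import Data.Nat.Properties
open import Data.Nat.Tactic.RingSolver using (solve-∀)
open import Data.Product using (_×_; _,_; proj₁; proj₂; ∃)
open import Data.Product.Function.NonDependent.Propositional using (_×-↔_)
open import Data.Sum as Sum using (_⊎_; inj₁; inj₂)
open import Data.Sum.Function.Propositional using (_⊎-↔_)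
open import Data.Unit using (tt)
open import Function using (_∘_)
open import Function.Bundles using (_↔_; mk↔ₛ′; _⇔_; mk⇔; Equivalence)
open import Function.Properties.Inverse using (↔-sym; ↔-trans; ↔-refl)
open import Relation.Binary.Construct.Closure.ReflexiveTransitive using (ε; _◅_)
open import Relation.Binary.PropositionalEquality hiding ([_])
open import Relation.Nullary using (¬_; Dec; yes; no; does)
open import Relation.Nullary.Decidable using (_×-dec_)
open import Relation.Unary using (Decidable)

-- Sums of binomial terms

sumBelow : (ℕ → ℕ) → ℕ → ℕ
sumBelow f zero    = 0
sumBelow f (suc K) = f 0 + sumBelow (f ∘ suc) K

sumBelow-applyUpTo : ∀ f K → sum (applyUpTo f K) ≡ sumBelow f K
sumBelow-applyUpTo f zero    = refl
sumBelow-applyUpTo f (suc K) = cong (f 0 +_) (sumBelow-applyUpTo (f ∘ suc) K)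

sumBelow-cong : ∀ {f g} K → (∀ a → f a ≡ g a) → sumBelow f K ≡ sumBelow g K
sumBelow-cong zero    f≡g = refl
sumBelow-cong (suc K) f≡g = cong₂ _+_ (f≡g 0) (sumBelow-cong K (f≡g ∘ suc))

sumBelow-+ : ∀ f g K → sumBelow (λ a → f a + g a) K ≡ sumBelow f K + sumBelow g K
sumBelow-+ f g zero    = refl
sumBelow-+ f g (suc K) rewrite sumBelow-+ (f ∘ suc) (g ∘ suc) K =
  +-interchange (f 0) (g 0) (sumBelow (f ∘ suc) K) (sumBelow (g ∘ suc) K)
  where
  +-interchange : ∀ a b c d → a + b + (c + d) ≡ a + c + (b + d)
  +-interchange = solve-∀

sumBelow-*ˡ : ∀ c f K → sumBelow (λ a → c * f a) K ≡ c * sumBelow f K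
sumBelow-*ˡ c f zero    = sym (*-zeroʳ c)
sumBelow-*ˡ c f (suc K) rewrite sumBelow-*ˡ c (f ∘ suc) K =
  sym (*-distribˡ-+ c (f 0) (sumBelow (f ∘ suc) K))

sumBelow-zero : ∀ f K → (∀ a → f a ≡ 0) → sumBelow f K ≡ 0
sumBelow-zero f zero    f≡0 = refl
sumBelow-zero f (suc K) f≡0 rewrite f≡0 0 = sumBelow-zero (f ∘ suc) K (f≡0 ∘ suc)

sumBelow-split : ∀ f K d → sumBelow f (K + d) ≡ sumBelow f K + sumBelow (λ a → f (K + a)) d
sumBelow-split f zero    d = refl
sumBelow-split f (suc K) d rewrite sumBelow-split (f ∘ suc) K d = sym (+-assoc (f 0) _ _)

sumBelow-extend : ∀ f {K K'} → K ≤ K' → (∀ a → K ≤ a → f a ≡ 0) → sumBelow f K ≡ sumBelow f K'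
sumBelow-extend f {K} K≤K' tail≡0 with m≤n⇒∃[o]m+o≡n K≤K'
... | d , refl
  rewrite sumBelow-split f K d
        | sumBelow-zero (λ a → f (K + a)) d (λ a → tail≡0 (K + a) (m≤m+n K a))
  = sym (+-identityʳ _)

binomTerm : ℕ → ℕ → ℕ → ℕ → ℕ
binomTerm Q m n a = (m C a) * (n C a) * Q ^ a

binomTerm-vanishes : ∀ Q m n a → m ⊓ n < a → binomTerm Q m n a ≡ 0
binomTerm-vanishes Q m n a m⊓n<a with ≤-total m n
... | inj₁ m≤n rewrite k>n⇒nCk≡0 (subst (_< a) (m≤n⇒m⊓n≡m m≤n) m⊓n<a) = refl
... | inj₂ n≤m rewrite k>n⇒nCk≡0 (subst (_< a) (m≥n⇒m⊓n≡n n≤m) m⊓n<a) | *-zeroʳ (m C a) = refl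

binomSum≡sumBelow : ∀ m n Q {N} → suc (m ⊓ n) ≤ N → binomSum m n Q ≡ sumBelow (binomTerm Q m n) N
binomSum≡sumBelow m n Q {N} m⊓n<N = begin
  binomSum m n Q                   ≡⟨ cong sum (LP.map-applyUpTo (λ a → a) T (suc (m ⊓ n))) ⟩
  sum (applyUpTo T (suc (m ⊓ n)))  ≡⟨ sumBelow-applyUpTo T (suc (m ⊓ n)) ⟩
  sumBelow T (suc (m ⊓ n))         ≡⟨ sumBelow-extend T m⊓n<N (binomTerm-vanishes Q m n) ⟩
  sumBelow T N                     ∎
  where
  open ≡-Reasoning
  T = binomTerm Q m n

binomTerm-pascal : ∀ Q m n a →
  binomTerm Q (suc m) (suc n) (suc a) + binomTerm Q m n (suc a)
    ≡ binomTerm Q m (suc n) (suc a) + binomTerm Q (suc m) n (suc a) + Q * binomTerm Q m n a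
binomTerm-pascal Q m n a
  rewrite sym (nCk+nC[k+1]≡[n+1]C[k+1] m a) | sym (nCk+nC[k+1]≡[n+1]C[k+1] n a) =
  expand (m C a) (m C suc a) (n C a) (n C suc a) Q (Q ^ a)
  where
  expand : ∀ c c' d d' Q R → (c + c') * (d + d') * (Q * R) + c' * d' * (Q * R)
                         ≡ c' * (d + d') * (Q * R) + (c + c') * d' * (Q * R) + Q * (c * d * R)
  expand = solve-∀

-- The a = 0 terms are all 1; the others are matched by binomTerm-pascal.
sumBelow-pascal : ∀ Q m n N →
  sumBelow (binomTerm Q (suc m) (suc n)) (suc N) + sumBelow (binomTerm Q m n) (suc N)
    ≡ sumBelow (binomTerm Q m (suc n)) (suc N) + sumBelow (binomTerm Q (suc m) n) (suc N)
      + Q * sumBelow (binomTerm Q m n) N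
sumBelow-pascal Q m n N = begin
  (1 + S11) + (1 + S00)
    ≡⟨ shuffle₁ S11 S00 ⟩
  2 + (S11 + S00)
    ≡⟨ cong (2 +_) (sym (sumBelow-+ (T11 ∘ suc) (T00 ∘ suc) N)) ⟩
  2 + sumBelow (λ a → T11 (suc a) + T00 (suc a)) N
    ≡⟨ cong (2 +_) (sumBelow-cong N (binomTerm-pascal Q m n)) ⟩
  2 + sumBelow (λ a → T01 (suc a) + T10 (suc a) + Q * T00 a) N
    ≡⟨ cong (2 +_) (sumBelow-+ _ (λ a → Q * T00 a) N) ⟩
  2 + (sumBelow (λ a → T01 (suc a) + T10 (suc a)) N + sumBelow (λ a → Q * T00 a) N)
    ≡⟨ cong₂ (λ u v → 2 + (u + v)) (sumBelow-+ (T01 ∘ suc) (T10 ∘ suc) N) (sumBelow-*ˡ Q T00 N) ⟩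
  2 + (S01 + S10 + Q * sumBelow T00 N)
    ≡⟨ shuffle₂ S01 S10 (Q * sumBelow T00 N) ⟩
  (1 + S01) + (1 + S10) + Q * sumBelow T00 N
    ∎
  where
  open ≡-Reasoning
  T11 = binomTerm Q (suc m) (suc n)
  T00 = binomTerm Q m n
  T01 = binomTerm Q m (suc n)
  T10 = binomTerm Q (suc m) n
  S11 = sumBelow (T11 ∘ suc) N
  S00 = sumBelow (T00 ∘ suc) N
  S01 = sumBelow (T01 ∘ suc) N
  S10 = sumBelow (T10 ∘ suc) N
  shuffle₁ : ∀ u v → (1 + u) + (1 + v) ≡ 2 + (u + v)
  shuffle₁ = solve-∀
  shuffle₂ : ∀ u v w → 2 + (u + v + w) ≡ (1 + u) + (1 + v) + w
  shuffle₂ = solve-∀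

-- Delannoy numbers

binomSum-recurrence : ∀ q m n →
  binomSum (suc m) (suc n) (suc q)
    ≡ binomSum m (suc n) (suc q) + binomSum (suc m) n (suc q) + q * binomSum m n (suc q)
binomSum-recurrence q m n = +-cancelʳ-≡ _ _ _ (begin
    B11 + B00
  ≡⟨ cong₂ _+_ (binomSum≡sumBelow (suc m) (suc n) Q (s≤s (s≤s (m⊓n≤m+n m n))))
               (binomSum≡sumBelow m n Q (s≤s (m≤n⇒m≤1+n (m⊓n≤m+n m n)))) ⟩
    sumBelow (binomTerm Q (suc m) (suc n)) (suc N) + sumBelow (binomTerm Q m n) (suc N)
  ≡⟨ sumBelow-pascal Q m n N ⟩
    sumBelow (binomTerm Q m (suc n)) (suc N) + sumBelow (binomTerm Q (suc m) n) (suc N)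
      + Q * sumBelow (binomTerm Q m n) N
  ≡⟨ sym (cong₂ (λ u v → u + v + Q * sumBelow (binomTerm Q m n) N)
                (binomSum≡sumBelow m (suc n) Q (s≤s (≤-trans (m⊓n≤m m (suc n)) (m≤n⇒m≤1+n (m≤m+n m n)))))
                (binomSum≡sumBelow (suc m) n Q (s≤s (≤-trans (m⊓n≤n (suc m) n) (m≤n⇒m≤1+n (m≤n+m n m)))))) ⟩
    B01 + B10 + Q * sumBelow (binomTerm Q m n) N
  ≡⟨ cong (λ u → B01 + B10 + Q * u) (sym (binomSum≡sumBelow m n Q (s≤s (m⊓n≤m+n m n)))) ⟩
    B01 + B10 + Q * B00
  ≡⟨ peel-suc B01 B10 B00 q ⟩
    B01 + B10 + q * B00 + B00
  ∎)
  where
  open ≡-Reasoning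
  Q = suc q
  N = suc (m + n)
  B11 = binomSum (suc m) (suc n) Q
  B00 = binomSum m n Q
  B01 = binomSum m (suc n) Q
  B10 = binomSum (suc m) n Q
  peel-suc : ∀ u v w q → u + v + suc q * w ≡ u + v + q * w + w
  peel-suc = solve-∀

binomSum-zeroʳ : ∀ m Q → binomSum m 0 Q ≡ 1
binomSum-zeroʳ m Q rewrite ⊓-zeroʳ m = refl

delannoy : ℕ → ℕ → ℕ → ℕ
delannoy q zero    n       = 1
delannoy q (suc m) zero    = 1
delannoy q (suc m) (suc n) = delannoy q m (suc n) + delannoy q (suc m) n + q * delannoy q m n

delannoy-zeroʳ : ∀ q m → delannoy q m 0 ≡ 1
delannoy-zeroʳ q zero    = refl
delannoy-zeroʳ q (suc m) = refl

delannoy≡binomSum : ∀ q m n → delannoy q m n ≡ binomSum m n (suc q)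
delannoy≡binomSum q zero    n       = refl
delannoy≡binomSum q (suc m) zero    = sym (binomSum-zeroʳ (suc m) (suc q))
delannoy≡binomSum q (suc m) (suc n)
  rewrite delannoy≡binomSum q m (suc n) | delannoy≡binomSum q (suc m) n | delannoy≡binomSum q m n
  = sym (binomSum-recurrence q m n)

Del-origin↔ : ∀ {q} → Del q 0 0 ↔ Fin 1
Del-origin↔ = mk↔ₛ′ (λ _ → F.zero) (λ _ → start) (λ { F.zero → refl ; (F.suc ()) }) (λ { start → refl })

Del-north↔ : ∀ {q n} → Del q 0 (suc n) ↔ Del q 0 n
Del-north↔ = mk↔ₛ′ (λ { (north p) → p }) north (λ _ → refl) (λ { (north p) → refl })

Del-east↔ : ∀ {q m} → Del q (suc m) 0 ↔ Del q m 0
Del-east↔ = mk↔ₛ′ (λ { (east p) → p }) east (λ _ → refl) (λ { (east p) → refl })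

Del-lastStep↔ : ∀ {q m n} →
  Del q (suc m) (suc n) ↔ ((Del q m (suc n) ⊎ Del q (suc m) n) ⊎ (Fin q × Del q m n))
Del-lastStep↔ {q} {m} {n} = mk↔ₛ′ lastStep extend
  (λ { (inj₁ (inj₁ p)) → refl ; (inj₁ (inj₂ p)) → refl ; (inj₂ (c , p)) → refl })
  (λ { (east p) → refl ; (north p) → refl ; (diag c p) → refl })
  where
  lastStep : Del q (suc m) (suc n) → (Del q m (suc n) ⊎ Del q (suc m) n) ⊎ (Fin q × Del q m n)
  lastStep (east p)   = inj₁ (inj₁ p)
  lastStep (north p)  = inj₁ (inj₂ p)
  lastStep (diag c p) = inj₂ (c , p)
  extend : (Del q m (suc n) ⊎ Del q (suc m) n) ⊎ (Fin q × Del q m n) → Del q (suc m) (suc n)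
  extend (inj₁ (inj₁ p)) = east p
  extend (inj₁ (inj₂ p)) = north p
  extend (inj₂ (c , p))  = diag c p

Del↔delannoy : ∀ q m n → Del q m n ↔ Fin (delannoy q m n)
Del↔delannoy q zero    zero    = Del-origin↔
Del↔delannoy q zero    (suc n) = ↔-trans Del-north↔ (Del↔delannoy q zero n)
Del↔delannoy q (suc m) zero    =
  ↔-trans Del-east↔ (subst (λ k → Del q m 0 ↔ Fin k) (delannoy-zeroʳ q m) (Del↔delannoy q m zero))
Del↔delannoy q (suc m) (suc n) =
  ↔-trans Del-lastStep↔
    (↔-trans ((Del↔delannoy q m (suc n) ⊎-↔ Del↔delannoy q (suc m) n) ⊎-↔ (↔-refl ×-↔ Del↔delannoy q m n))
      (↔-trans (↔-sym FP.+↔⊎ ⊎-↔ ↔-sym FP.*↔×) (↔-sym FP.+↔⊎)))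

Del↔binomSum : ∀ q m n → Del q m n ↔ Fin (binomSum m n (suc q))
Del↔binomSum q m n = subst (λ k → Del q m n ↔ Fin k) (delannoy≡binomSum q m n) (Del↔delannoy q m n)

-- Editing lists at a position

module _ {A : Set} {R : A → A → Set} where

  AllPairs-++⁻ : ∀ xs {ys} → AllPairs R (xs ++ ys) →
                 AllPairs R xs × AllPairs R ys × All (λ a → All (R a) ys) xs
  AllPairs-++⁻ []       rs       = [] , rs , []
  AllPairs-++⁻ (a ∷ xs) (r ∷ rs) with AllPairs-++⁻ xs rs
  ... | pxs , pys , cross = AllP.++⁻ˡ xs r ∷ pxs , pys , AllP.++⁻ʳ xs r ∷ cross

  AllPairs-delete : ∀ p {a s} → AllPairs R (p ++ a ∷ s) → AllPairs R (p ++ s)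
  AllPairs-delete p rs with AllPairs-++⁻ p rs
  ... | pp , _ ∷ ps , cross = APP.++⁺ pp ps (All.map All.tail cross)

  AllPairs-insert : ∀ p {a s} → AllPairs R (p ++ s) → All (λ c → R c a) p → All (R a) s →
                    AllPairs R (p ++ a ∷ s)
  AllPairs-insert p rs before after with AllPairs-++⁻ p rs
  ... | pp , ps , cross = APP.++⁺ pp (after ∷ ps) (All.zipWith (λ (rca , rcs) → rca ∷ rcs) (before , cross))

  AllPairs-swap : ∀ p {a b s} → AllPairs R (p ++ a ∷ b ∷ s) → R b a → AllPairs R (p ++ b ∷ a ∷ s)
  AllPairs-swap p rs rba with AllPairs-++⁻ p rs
  ... | pp , (_ ∷ ras) ∷ rbs ∷ ps , cross =
    APP.++⁺ pp ((rba ∷ rbs) ∷ ras ∷ ps) (All.map (λ { (rca ∷ rcb ∷ rcs) → rcb ∷ rca ∷ rcs }) cross)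

  AllPairs-adjacent : ∀ p {a b s} → AllPairs R (p ++ a ∷ b ∷ s) → R a b
  AllPairs-adjacent p rs with AllPairs-++⁻ p rs
  ... | _ , (rab ∷ _) ∷ _ , _ = rab

  AllPairs-before : ∀ p {t} → AllPairs R (p ++ t) → All (λ c → All (R c) t) p
  AllPairs-before p rs = proj₂ (proj₂ (AllPairs-++⁻ p rs))

module _ {A : Set} where

  ∉-delete : ∀ (p : List A) {a s} → Unique (p ++ a ∷ s) → a ∉ p ++ s
  ∉-delete p u a∈ with AllPairs-++⁻ p u | ∈-++⁻ p a∈
  ... | _ , _ , cross | inj₁ a∈p = All.head (All.lookup cross a∈p) refl
  ... | _ , a∉s ∷ _ , _ | inj₂ a∈s = All.lookup a∉s a∈s refl

  ∈-middle : ∀ (p : List A) {a s} → a ∈ p ++ a ∷ s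
  ∈-middle p = ∈-++⁺ʳ p (here refl)

-- Two ranks on words

bit : Bool → ℕ
bit true  = 1
bit false = 0

bit≤1 : ∀ b → bit b ≤ 1
bit≤1 true  = s≤s z≤n
bit≤1 false = z≤n

_⊑_ : Bool → Bool → Set
a ⊑ b = bit a ≤ bit b

≤ᵇ-true : ∀ {a b} → a ≤ b → (a ≤ᵇ b) ≡ true
≤ᵇ-true a≤b = Equivalence.to T-≡ (≤⇒≤ᵇ a≤b)

≤ᵇ-true⇒≤ : ∀ {a b} → (a ≤ᵇ b) ≡ true → a ≤ b
≤ᵇ-true⇒≤ {a} {b} a≤ᵇb = ≤ᵇ⇒≤ a b (Equivalence.from T-≡ a≤ᵇb)

false⊑ : ∀ {b} → false ⊑ b
false⊑ = z≤n

⊑true : ∀ {b} → b ⊑ true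
⊑true {b} = bit≤1 b

false⊏true : ∀ {a b} → a ≡ false → b ≡ true → bit a < bit b
false⊏true refl refl = s≤s z≤n

∑ : ∀ {k} → (Fin k → ℕ) → ℕ
∑ {zero}  f = 0
∑ {suc k} f = f F.zero + ∑ (f ∘ F.suc)

∑-cong : ∀ {k} {f g : Fin k → ℕ} → (∀ i → f i ≡ g i) → ∑ f ≡ ∑ g
∑-cong {zero}  f≡g = refl
∑-cong {suc k} f≡g = cong₂ _+_ (f≡g F.zero) (∑-cong (f≡g ∘ F.suc))

∑-mono : ∀ {k} {f g : Fin k → ℕ} → (∀ i → f i ≤ g i) → ∑ f ≤ ∑ g
∑-mono {zero}  f≤g = z≤n
∑-mono {suc k} f≤g = +-mono-≤ (f≤g F.zero) (∑-mono (f≤g ∘ F.suc))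

∑-mono-< : ∀ {k} {f g : Fin k → ℕ} → (∀ i → f i ≤ g i) → ∀ c → f c < g c → ∑ f < ∑ g
∑-mono-< f≤g F.zero    fc<gc = +-mono-<-≤ fc<gc (∑-mono (f≤g ∘ F.suc))
∑-mono-< f≤g (F.suc c) fc<gc = +-mono-≤-< (f≤g F.zero) (∑-mono-< (f≤g ∘ F.suc) c fc<gc)

∑-≤-suc : ∀ {k} {f g : Fin k → ℕ} (c : Fin k) →
          (∀ i → i ≢ c → g i ≤ f i) → g c ≤ suc (f c) → ∑ g ≤ suc (∑ f)
∑-≤-suc {f = f} F.zero    g≤f gc≤ = +-mono-≤ gc≤ (∑-mono (λ i → g≤f (F.suc i) (λ ())))
∑-≤-suc {f = f} (F.suc c) g≤f gc≤ = ≤-trans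
  (+-mono-≤ (g≤f F.zero (λ ())) (∑-≤-suc c (λ i i≢c → g≤f (F.suc i) (i≢c ∘ FP.suc-injective)) gc≤))
  (≤-reflexive (+-suc (f F.zero) _))

module _ {m n : ℕ} where

  verdict : (Letter m n → Maybe Bool) → Bool → Word m n → Bool
  verdict g d []      = d
  verdict g d (a ∷ w) with g a
  ... | just v  = v
  ... | nothing = verdict g d w

  module _ (g : Letter m n → Maybe Bool) (d : Bool) where

    verdict-++-mono : ∀ p {t t'} → verdict g d t ⊑ verdict g d t' →
                      verdict g d (p ++ t) ⊑ verdict g d (p ++ t')
    verdict-++-mono []      le = le
    verdict-++-mono (a ∷ p) le with g a
    ... | just v  = ≤-refl
    ... | nothing = verdict-++-mono p le

    verdict-++-cong : ∀ p {t t'} → verdict g d t ≡ verdict g d t' →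
                      verdict g d (p ++ t) ≡ verdict g d (p ++ t')
    verdict-++-cong []      eq = eq
    verdict-++-cong (a ∷ p) eq with g a
    ... | just v  = refl
    ... | nothing = verdict-++-cong p eq

    verdict-++-decided : ∀ p t t' {a v} → a ∈ p → g a ≡ just v →
                         verdict g d (p ++ t) ≡ verdict g d (p ++ t')
    verdict-++-decided (b ∷ p) t t' (here refl) ga≡v rewrite ga≡v = refl
    verdict-++-decided (b ∷ p) t t' (there a∈p) ga≡v with g b
    ... | just w  = refl
    ... | nothing = verdict-++-decided p t t' a∈p ga≡v

    verdict-++-skip : ∀ p {t} → All (λ a → g a ≡ nothing) p → verdict g d (p ++ t) ≡ verdict g d t
    verdict-++-skip []      []            = refl
    verdict-++-skip (a ∷ p) (ga≡· ∷ skip) rewrite ga≡· = verdict-++-skip p skip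

  onY : Fin n → Letter m n → Maybe Bool
  onY j (x _) = nothing
  onY j (y k) = if does (j FP.≟ k) then just true else nothing

  onX : Fin m → Letter m n → Maybe Bool
  onX i (x k) = if does (i FP.≟ k) then just false else nothing
  onX i (y _) = nothing

  onXY : Fin m → Fin n → Letter m n → Maybe Bool
  onXY i j (x k) = if does (i FP.≟ k) then just false else nothing
  onXY i j (y k) = if does (j FP.≟ k) then just true else nothing

  onAbove : Fin m → Fin n → Letter m n → Maybe Bool
  onAbove i j (x k) = if does (i FP.≤? k) then just false else nothing
  onAbove i j (y k) = if does (j FP.≤? k) then just true else nothing

  hasY : Fin n → Word m n → Bool
  hasY j = verdict (onY j) false

  lacksX : Fin m → Word m n → Bool
  lacksX i = verdict (onX i) true

  yBeforeX : Fin m → Fin n → Word m n → Bool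
  yBeforeX i j = verdict (onXY i j) true

  yFirstAbove : Fin m → Fin n → Word m n → Bool
  yFirstAbove i j = verdict (onAbove i j) false

  hasY-∈ : ∀ j w → y j ∈ w → hasY j w ≡ true
  hasY-∈ j (a ∷ w) (here refl) with j FP.≟ j
  ... | yes _  = refl
  ... | no j≢j = ⊥-elim (j≢j refl)
  hasY-∈ j (x k ∷ w) (there yj∈w) = hasY-∈ j w yj∈w
  hasY-∈ j (y k ∷ w) (there yj∈w) with j FP.≟ k
  ... | yes _ = refl
  ... | no _  = hasY-∈ j w yj∈w

  hasY-∉ : ∀ j w → y j ∉ w → hasY j w ≡ false
  hasY-∉ j []        _     = refl
  hasY-∉ j (x k ∷ w) yj∉w = hasY-∉ j w (yj∉w ∘ there)
  hasY-∉ j (y k ∷ w) yj∉w with j FP.≟ k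
  ... | yes refl = ⊥-elim (yj∉w (here refl))
  ... | no _     = hasY-∉ j w (yj∉w ∘ there)

  lacksX-∈ : ∀ i w → x i ∈ w → lacksX i w ≡ false
  lacksX-∈ i (a ∷ w) (here refl) with i FP.≟ i
  ... | yes _  = refl
  ... | no i≢i = ⊥-elim (i≢i refl)
  lacksX-∈ i (y k ∷ w) (there xi∈w) = lacksX-∈ i w xi∈w
  lacksX-∈ i (x k ∷ w) (there xi∈w) with i FP.≟ k
  ... | yes _ = refl
  ... | no _  = lacksX-∈ i w xi∈w

  lacksX-∉ : ∀ i w → x i ∉ w → lacksX i w ≡ true
  lacksX-∉ i []        _     = refl
  lacksX-∉ i (y k ∷ w) xi∉w = lacksX-∉ i w (xi∉w ∘ there)
  lacksX-∉ i (x k ∷ w) xi∉w with i FP.≟ k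
  ... | yes refl = ⊥-elim (xi∉w (here refl))
  ... | no _     = lacksX-∉ i w (xi∉w ∘ there)

  lacksX-delX : ∀ i i' s → lacksX i (x i' ∷ s) ⊑ lacksX i s
  lacksX-delX i i' s with i FP.≟ i'
  ... | yes _ = false⊑
  ... | no _  = ≤-refl

  yBeforeX-delX : ∀ i j i' s → yBeforeX i j (x i' ∷ s) ⊑ yBeforeX i j s
  yBeforeX-delX i j i' s with i FP.≟ i'
  ... | yes _ = false⊑
  ... | no _  = ≤-refl

  yFirstAbove-delX : ∀ i j i' s → yFirstAbove i j (x i' ∷ s) ⊑ yFirstAbove i j s
  yFirstAbove-delX i j i' s with F.toℕ i ≤ᵇ F.toℕ i'
  ... | true  = false⊑
  ... | false = ≤-refl

  hasY-insY : ∀ j j' s → hasY j s ⊑ hasY j (y j' ∷ s)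
  hasY-insY j j' s with j FP.≟ j'
  ... | yes _ = ⊑true
  ... | no _  = ≤-refl

  yBeforeX-insY : ∀ i j j' s → yBeforeX i j s ⊑ yBeforeX i j (y j' ∷ s)
  yBeforeX-insY i j j' s with j FP.≟ j'
  ... | yes _ = ⊑true
  ... | no _  = ≤-refl

  yFirstAbove-insY : ∀ i j j' s → yFirstAbove i j s ⊑ yFirstAbove i j (y j' ∷ s)
  yFirstAbove-insY i j j' s with F.toℕ j ≤ᵇ F.toℕ j'
  ... | true  = ⊑true
  ... | false = ≤-refl

  hasY-swap : ∀ j i' j' s → hasY j (x i' ∷ y j' ∷ s) ≡ hasY j (y j' ∷ x i' ∷ s)
  hasY-swap j i' j' s with j FP.≟ j'
  ... | yes _ = refl
  ... | no _  = refl

  lacksX-swap : ∀ i i' j' s → lacksX i (x i' ∷ y j' ∷ s) ≡ lacksX i (y j' ∷ x i' ∷ s)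
  lacksX-swap i i' j' s with i FP.≟ i'
  ... | yes _ = refl
  ... | no _  = refl

  yBeforeX-swap : ∀ i j i' j' s → yBeforeX i j (x i' ∷ y j' ∷ s) ⊑ yBeforeX i j (y j' ∷ x i' ∷ s)
  yBeforeX-swap i j i' j' s with i FP.≟ i'
  ... | yes _   = false⊑
  ... | no i≢i' with j FP.≟ j'
  ...   | yes _ = ≤-refl
  ...   | no _ with i FP.≟ i'
  ...     | yes i≡i' = ⊥-elim (i≢i' i≡i')
  ...     | no _     = ≤-refl

  yBeforeX-swap-other : ∀ i j i' j' s → i ≢ i' ⊎ j ≢ j' →
                        yBeforeX i j (y j' ∷ x i' ∷ s) ⊑ yBeforeX i j (x i' ∷ y j' ∷ s)
  yBeforeX-swap-other i j i' j' s other with j FP.≟ j'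
  yBeforeX-swap-other i j i' j' s other | yes j≡j' with i FP.≟ i'
  yBeforeX-swap-other i j i' j' s (inj₁ i≢i') | yes j≡j' | yes i≡i' = ⊥-elim (i≢i' i≡i')
  yBeforeX-swap-other i j i' j' s (inj₂ j≢j') | yes j≡j' | yes i≡i' = ⊥-elim (j≢j' j≡j')
  yBeforeX-swap-other i j i' j' s other | yes j≡j' | no _ with j FP.≟ j'
  ... | yes _    = ≤-refl
  ... | no j≢j' = ⊥-elim (j≢j' j≡j')
  yBeforeX-swap-other i j i' j' s other | no j≢j' with i FP.≟ i'
  ... | yes _ = ≤-refl
  ... | no _ with j FP.≟ j'
  ...   | yes j≡j' = ⊥-elim (j≢j' j≡j')
  ...   | no _     = ≤-refl

  yBeforeX-swap-self : ∀ i j s → yBeforeX i j (x i ∷ y j ∷ s) ≡ false × yBeforeX i j (y j ∷ x i ∷ s) ≡ true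
  yBeforeX-swap-self i j s with i FP.≟ i | j FP.≟ j
  ... | yes _  | yes _  = refl , refl
  ... | no i≢i | _      = ⊥-elim (i≢i refl)
  ... | _      | no j≢j = ⊥-elim (j≢j refl)

  yFirstAbove-swap : ∀ i j i' j' s → yFirstAbove i j (x i' ∷ y j' ∷ s) ⊑ yFirstAbove i j (y j' ∷ x i' ∷ s)
  yFirstAbove-swap i j i' j' s with F.toℕ i ≤ᵇ F.toℕ i' in i≤i'
  ... | true = z≤n
  ... | false with F.toℕ j ≤ᵇ F.toℕ j'
  ...   | true  = ≤-refl
  ...   | false rewrite i≤i' = ≤-refl

  yFirstAbove-swap-self : ∀ i j s →
                          yFirstAbove i j (x i ∷ y j ∷ s) ≡ false × yFirstAbove i j (y j ∷ x i ∷ s) ≡ true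
  yFirstAbove-swap-self i j s rewrite ≤ᵇ-true (≤-refl {F.toℕ i}) | ≤ᵇ-true (≤-refl {F.toℕ j}) = refl , refl

  base : Word m n → ℕ
  base w = ∑ (λ j → bit (hasY j w)) + ∑ (λ i → bit (lacksX i w))

  pairCount : (Fin m → Fin n → Word m n → Bool) → Word m n → ℕ
  pairCount c w = ∑ (λ i → ∑ (λ j → bit (c i j w)))

  swapRank : Word m n → ℕ
  swapRank w = base w + pairCount yBeforeX w

  indelRank : Word m n → ℕ
  indelRank w = base w + pairCount yFirstAbove w

  pairCount-mono : ∀ c w u → (∀ i j → c i j w ⊑ c i j u) → pairCount c w ≤ pairCount c u
  pairCount-mono c w u w⊑u = ∑-mono (λ i → ∑-mono (w⊑u i))

  pairCount-mono-< : ∀ c w u → (∀ i j → c i j w ⊑ c i j u) →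
                     ∀ i j → c i j w ≡ false → c i j u ≡ true → pairCount c w < pairCount c u
  pairCount-mono-< c w u w⊑u i j cw≡f cu≡t =
    ∑-mono-< (λ i → ∑-mono (w⊑u i)) i (∑-mono-< (w⊑u i) j (false⊏true cw≡f cu≡t))

  base-delX : ∀ p s i → IsShuffle (p ++ x i ∷ s) → base (p ++ x i ∷ s) < base (p ++ s)
  base-delX p s i (distinct , _) = +-mono-≤-<
    (∑-mono (λ j → verdict-++-mono (onY j) false p ≤-refl))
    (∑-mono-< (λ i' → verdict-++-mono (onX i') true p (lacksX-delX i' i s)) i
      (false⊏true (lacksX-∈ i _ (∈-middle p)) (lacksX-∉ i _ (∉-delete p distinct))))

  base-insY : ∀ p s j → IsShuffle (p ++ y j ∷ s) → base (p ++ s) < base (p ++ y j ∷ s)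
  base-insY p s j (distinct , _) = +-mono-<-≤
    (∑-mono-< (λ j' → verdict-++-mono (onY j') false p (hasY-insY j' j s)) j
      (false⊏true (hasY-∉ j _ (∉-delete p distinct)) (hasY-∈ j _ (∈-middle p))))
    (∑-mono (λ i → verdict-++-mono (onX i) true p ≤-refl))

  base-swap : ∀ p s i j → base (p ++ x i ∷ y j ∷ s) ≡ base (p ++ y j ∷ x i ∷ s)
  base-swap p s i j = cong₂ _+_
    (∑-cong (λ j' → cong bit (verdict-++-cong (onY j') false p (hasY-swap j' i j s))))
    (∑-cong (λ i' → cong bit (verdict-++-cong (onX i') true p (lacksX-swap i' i j s))))

  yBeforeX-move : ∀ {w u} → Move w u → ∀ i j → yBeforeX i j w ⊑ yBeforeX i j u
  yBeforeX-move (indel (delX p s i')) i j = verdict-++-mono (onXY i j) true p (yBeforeX-delX i j i' s)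
  yBeforeX-move (indel (insY p s j')) i j = verdict-++-mono (onXY i j) true p (yBeforeX-insY i j j' s)
  yBeforeX-move (swap p s i' j')      i j = verdict-++-mono (onXY i j) true p (yBeforeX-swap i j i' j' s)

  yFirstAbove-move : ∀ {w u} → Move w u → ∀ i j → yFirstAbove i j w ⊑ yFirstAbove i j u
  yFirstAbove-move (indel (delX p s i')) i j = verdict-++-mono (onAbove i j) false p (yFirstAbove-delX i j i' s)
  yFirstAbove-move (indel (insY p s j')) i j = verdict-++-mono (onAbove i j) false p (yFirstAbove-insY i j j' s)
  yFirstAbove-move (swap p s i' j')      i j = verdict-++-mono (onAbove i j) false p (yFirstAbove-swap i j i' j' s)

  onXY-other : ∀ i j a → a ≢ x i → a ≢ y j → onXY i j a ≡ nothing
  onXY-other i j (x k) a≢xi _ with i FP.≟ k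
  ... | yes refl = ⊥-elim (a≢xi refl)
  ... | no _     = refl
  onXY-other i j (y k) _ a≢yj with j FP.≟ k
  ... | yes refl = ⊥-elim (a≢yj refl)
  ... | no _     = refl

  onAbove-earlier : ∀ i j a → a ≢ x i → a ≢ y j → Prec a (x i) → Prec a (y j) → onAbove i j a ≡ nothing
  onAbove-earlier i j (x k) a≢xi _ ¬i<k _ with F.toℕ i ≤ᵇ F.toℕ k in i≤k
  ... | false = refl
  ... | true  = ⊥-elim (¬i<k (FP.≤∧≢⇒< (≤ᵇ-true⇒≤ i≤k) (λ k≡i → a≢xi (cong x (sym k≡i)))))
  onAbove-earlier i j (y k) _ a≢yj _ ¬j<k with F.toℕ j ≤ᵇ F.toℕ k in j≤k
  ... | false = refl
  ... | true  = ⊥-elim (¬j<k (FP.≤∧≢⇒< (≤ᵇ-true⇒≤ j≤k) (λ k≡j → a≢yj (cong y (sym k≡j)))))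

  Earlier : Letter m n → Letter m n → Letter m n → Set
  Earlier a b c = c ≢ a × c ≢ b × Prec c a × Prec c b

  earlier-than-swap : ∀ p s i j → IsShuffle (p ++ x i ∷ y j ∷ s) → All (Earlier (x i) (y j)) p
  earlier-than-swap p s i j (distinct , ordered) = All.zipWith
    (λ { ((c≢xi ∷ c≢yj ∷ _) , (c≺xi ∷ c≺yj ∷ _)) → c≢xi , c≢yj , c≺xi , c≺yj })
    (AllPairs-before p distinct , AllPairs-before p ordered)

  swapRank-step : ∀ {w u} → Step w u → swapRank w < swapRank u
  swapRank-step (sw , _ , mv@(indel (delX p s i))) =
    +-mono-<-≤ (base-delX p s i sw) (pairCount-mono yBeforeX (p ++ x i ∷ s) (p ++ s) (yBeforeX-move mv))
  swapRank-step (_ , su , mv@(indel (insY p s j))) =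
    +-mono-<-≤ (base-insY p s j su) (pairCount-mono yBeforeX (p ++ s) (p ++ y j ∷ s) (yBeforeX-move mv))
  swapRank-step (sw , _ , mv@(swap p s i j)) = +-mono-≤-< (≤-reflexive (base-swap p s i j))
    (pairCount-mono-< yBeforeX (p ++ x i ∷ y j ∷ s) (p ++ y j ∷ x i ∷ s) (yBeforeX-move mv) i j
      (trans (verdict-++-skip (onXY i j) true p skip) (proj₁ (yBeforeX-swap-self i j s)))
      (trans (verdict-++-skip (onXY i j) true p skip) (proj₂ (yBeforeX-swap-self i j s))))
    where
    skip : All (λ a → onXY i j a ≡ nothing) p
    skip = All.map (λ (a≢xi , a≢yj , _) → onXY-other i j _ a≢xi a≢yj) (earlier-than-swap p s i j sw)

  indelRank-step : ∀ {w u} → Step w u → indelRank w < indelRank u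
  indelRank-step (sw , _ , mv@(indel (delX p s i))) =
    +-mono-<-≤ (base-delX p s i sw) (pairCount-mono yFirstAbove (p ++ x i ∷ s) (p ++ s) (yFirstAbove-move mv))
  indelRank-step (_ , su , mv@(indel (insY p s j))) =
    +-mono-<-≤ (base-insY p s j su) (pairCount-mono yFirstAbove (p ++ s) (p ++ y j ∷ s) (yFirstAbove-move mv))
  indelRank-step (sw , _ , mv@(swap p s i j)) = +-mono-≤-< (≤-reflexive (base-swap p s i j))
    (pairCount-mono-< yFirstAbove (p ++ x i ∷ y j ∷ s) (p ++ y j ∷ x i ∷ s) (yFirstAbove-move mv) i j
      (trans (verdict-++-skip (onAbove i j) false p skip) (proj₁ (yFirstAbove-swap-self i j s)))
      (trans (verdict-++-skip (onAbove i j) false p skip) (proj₂ (yFirstAbove-swap-self i j s))))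
    where
    skip : All (λ a → onAbove i j a ≡ nothing) p
    skip = All.map (λ (a≢xi , a≢yj , a≺xi , a≺yj) → onAbove-earlier i j _ a≢xi a≢yj a≺xi a≺yj)
                   (earlier-than-swap p s i j sw)

  module _ (rank : Word m n → ℕ) (rank-step : ∀ {w u} → Step w u → rank w < rank u) where

    rank-≤B : ∀ {w u} → w ≤B u → rank w ≤ rank u
    rank-≤B ε          = ≤-refl
    rank-≤B (st ◅ w≤u) = ≤-trans (<⇒≤ (rank-step st)) (rank-≤B w≤u)

    rank-<B : ∀ {w u} → w <B u → rank w < rank u
    rank-<B (ε , w≢w)       = ⊥-elim (w≢w refl)
    rank-<B (st ◅ w≤u , _) = <-≤-trans (rank-step st) (rank-≤B w≤u)

    step⇒<B : ∀ {w u} → Step w u → w <B u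
    step⇒<B st = st ◅ ε , λ w≡u → <-irrefl (cong rank w≡u) (rank-step st)

    -- Anything strictly between w and u would have rank strictly between rank w and rank w + 1.
    step⇒lowerCover : ∀ {w u} → Step w u → rank u ≤ suc (rank w) → LowerCover u w
    step⇒lowerCover st@(sw , _ , _) ru≤ = sw , step⇒<B st , λ z _ w<z z<u →
      <-irrefl refl (<-≤-trans (<-≤-trans (+-monoʳ-< 1 (rank-<B w<z)) (rank-<B z<u)) ru≤)

  _≟W_ : (w u : Word m n) → Dec (w ≡ u)
  _≟W_ = LP.≡-dec _≟L_

  lowerCover⇒step : ∀ {u w} → LowerCover u w → Step w u
  lowerCover⇒step (_ , (ε , w≢w) , _) = ⊥-elim (w≢w refl)
  lowerCover⇒step {u} (_ , (_◅_ {j = v} st v≤u , _) , nothing-between) with v ≟W u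
  ... | yes refl = st
  ... | no v≢u   = ⊥-elim (nothing-between v (proj₁ (proj₂ st)) (step⇒<B swapRank swapRank-step st) (v≤u , v≢u))

  -- Good words and their lower covers

  IsShuffle-swap : ∀ (p s : Word m n) {a b} → IsShuffle (p ++ a ∷ b ∷ s) → a ≢ b → Prec b a →
                   IsShuffle (p ++ b ∷ a ∷ s)
  IsShuffle-swap p s (distinct , ordered) a≢b b≺a =
    AllPairs-swap p distinct (a≢b ∘ sym) , AllPairs-swap p ordered b≺a

  IsShuffle-delete : ∀ (p s : Word m n) {a} → IsShuffle (p ++ a ∷ s) → IsShuffle (p ++ s)
  IsShuffle-delete p s (distinct , ordered) = AllPairs-delete p distinct , AllPairs-delete p ordered

  HasAllX : Word m n → Set
  HasAllX u = ∀ i → x i ∈ u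

  data Paired : Word m n → Set where
    []   : Paired []
    x∷_  : ∀ {i w} → Paired w → Paired (x i ∷ w)
    yx∷_ : ∀ {i j w} → Paired w → Paired (y j ∷ x i ∷ w)

  data Unpaired : Word m n → Set where
    endsWithY : ∀ p j → Unpaired (p ++ y j ∷ [])
    yy        : ∀ p j k s → Unpaired (p ++ y j ∷ y k ∷ s)

  Unpaired-cons : ∀ a {w} → Unpaired w → Unpaired (a ∷ w)
  Unpaired-cons a (endsWithY p j) = endsWithY (a ∷ p) j
  Unpaired-cons a (yy p j k s)    = yy (a ∷ p) j k s

  paired-or-unpaired : ∀ w → Paired w ⊎ Unpaired w
  paired-or-unpaired []              = inj₁ []
  paired-or-unpaired (x i ∷ w)       = Sum.map x∷_ (Unpaired-cons (x i)) (paired-or-unpaired w)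
  paired-or-unpaired (y j ∷ [])      = inj₂ (endsWithY [] j)
  paired-or-unpaired (y j ∷ y k ∷ w) = inj₂ (yy [] j k w)
  paired-or-unpaired (y j ∷ x i ∷ w) =
    Sum.map yx∷_ (Unpaired-cons (y j) ∘ Unpaired-cons (x i)) (paired-or-unpaired w)

  Paired-next : ∀ p {j s} → Paired (p ++ y j ∷ s) → ∃ λ k → ∃ λ s' → s ≡ x k ∷ s'
  Paired-next []                (yx∷ _)    = _ , _ , refl
  Paired-next (x _ ∷ p)         (x∷ pw)    = Paired-next p pw
  Paired-next (y _ ∷ [])        ()
  Paired-next (y _ ∷ y _ ∷ p)   ()
  Paired-next (y _ ∷ x _ ∷ p)   (yx∷ pw)   = Paired-next p pw

  Unpaired⇒¬Paired : ∀ {w} → Unpaired w → ¬ Paired w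
  Unpaired⇒¬Paired (endsWithY p j) pw with Paired-next p pw
  ... | _ , _ , ()
  Unpaired⇒¬Paired (yy p j k s) pw with Paired-next p pw
  ... | _ , _ , ()

  ysOf : Word m n → List (Fin n)
  ysOf []        = []
  ysOf (x _ ∷ w) = ysOf w
  ysOf (y j ∷ w) = j ∷ ysOf w

  xsOf : Word m n → List (Fin m)
  xsOf []        = []
  xsOf (x i ∷ w) = i ∷ xsOf w
  xsOf (y _ ∷ w) = xsOf w

  numY : Word m n → ℕ
  numY u = length (ysOf u)

  swapHere : Letter m n → Word m n → List (Word m n)
  swapHere (y j) (x i ∷ s) = (x i ∷ y j ∷ s) ∷ []
  swapHere _     _         = []

  swapDowns : Word m n → List (Word m n)
  swapDowns []      = []
  swapDowns (a ∷ s) = swapHere a s ++ map (a ∷_) (swapDowns s)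

  ∈-swapDowns : ∀ p s i j → p ++ x i ∷ y j ∷ s ∈ swapDowns (p ++ y j ∷ x i ∷ s)
  ∈-swapDowns []      s i j = here refl
  ∈-swapDowns (a ∷ p) s i j =
    ∈-++⁺ʳ (swapHere a (p ++ y j ∷ x i ∷ s)) (∈-map⁺ (a ∷_) (∈-swapDowns p s i j))

  swapDowns-∈ : ∀ u w → w ∈ swapDowns u →
                ∃ λ p → ∃ λ s → ∃ λ i → ∃ λ j → w ≡ p ++ x i ∷ y j ∷ s × u ≡ p ++ y j ∷ x i ∷ s
  swapDowns-∈ (a ∷ u) w w∈ with ∈-++⁻ (swapHere a u) w∈
  swapDowns-∈ (y j ∷ x i ∷ s) w w∈ | inj₁ (here refl) = [] , s , i , j , refl , refl
  swapDowns-∈ (x _ ∷ u)       w w∈ | inj₁ ()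
  swapDowns-∈ (y _ ∷ [])      w w∈ | inj₁ ()
  swapDowns-∈ (y _ ∷ y _ ∷ _) w w∈ | inj₁ ()
  swapDowns-∈ (y j ∷ x i ∷ s) w w∈ | inj₁ (there ())
  ... | inj₂ w∈' with ∈-map⁻ (a ∷_) w∈'
  ... | w' , w'∈ , refl with swapDowns-∈ u w' w'∈
  ... | p , s , i , j , refl , refl = a ∷ p , s , i , j , refl , refl

  swapDowns-unique : ∀ u → Unique (swapDowns u)
  swapDowns-unique []      = []
  swapDowns-unique (a ∷ u) =
    UP.++⁺ (swapHere-unique a u) (UP.map⁺ LP.∷-injectiveʳ (swapDowns-unique u)) (disjoint a u)
    where
    swapHere-unique : ∀ a u → Unique (swapHere a u)
    swapHere-unique (y j) (x i ∷ s) = [] ∷ []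
    swapHere-unique (x _) _         = []
    swapHere-unique (y _) []        = []
    swapHere-unique (y _) (y _ ∷ _) = []
    disjoint : ∀ a u {v} → ¬ (v ∈ swapHere a u × v ∈ map (a ∷_) (swapDowns u))
    disjoint (y j) (x i ∷ s) (here refl , v∈) with ∈-map⁻ (y j ∷_) v∈
    ... | _ , _ , ()

  swapDowns-length : ∀ {u} → Paired u → length (swapDowns u) ≡ numY u
  swapDowns-length []                  = refl
  swapDowns-length {x i ∷ u} (x∷ pu)   = trans (LP.length-map (x i ∷_) (swapDowns u)) (swapDowns-length pu)
  swapDowns-length {y j ∷ x i ∷ u} (yx∷ pu) = cong suc (begin
    length (map (y j ∷_) (map (x i ∷_) (swapDowns u))) ≡⟨ LP.length-map (y j ∷_) (map (x i ∷_) (swapDowns u)) ⟩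
    length (map (x i ∷_) (swapDowns u))                 ≡⟨ LP.length-map (x i ∷_) (swapDowns u) ⟩
    length (swapDowns u)                                ≡⟨ swapDowns-length pu ⟩
    numY u                                              ∎)
    where open ≡-Reasoning

  open DecMembership {A = Letter m n} _≟L_ using (_∈?_)

  Good : Word m n → Set
  Good u = HasAllX u × Paired u

  swapRank-swap : ∀ p s i j → swapRank (p ++ y j ∷ x i ∷ s) ≤ suc (swapRank (p ++ x i ∷ y j ∷ s))
  swapRank-swap p s i j = ≤-trans
    (+-mono-≤ (≤-reflexive (sym (base-swap p s i j))) pairs≤)
    (≤-reflexive (+-suc (base (p ++ x i ∷ y j ∷ s)) _))
    where
    pairs≤ : pairCount yBeforeX (p ++ y j ∷ x i ∷ s) ≤ suc (pairCount yBeforeX (p ++ x i ∷ y j ∷ s))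
    pairs≤ = ∑-≤-suc i
      (λ i' i'≢i → ∑-mono (λ j' →
        verdict-++-mono (onXY i' j') true p (yBeforeX-swap-other i' j' i j s (inj₁ i'≢i))))
      (∑-≤-suc j
        (λ j' j'≢j → verdict-++-mono (onXY i j') true p (yBeforeX-swap-other i j' i j s (inj₂ j'≢j)))
        (≤-trans (bit≤1 _) (s≤s z≤n)))

  insY-after-x : ∀ (p s : Word m n) k j → IsShuffle (p ++ x k ∷ s) → IsShuffle (p ++ x k ∷ y j ∷ s) →
                 Step (p ++ x k ∷ s) (p ++ x k ∷ y j ∷ s)
  insY-after-x p s k j sw su = sw , su ,
    subst₂ Move (LP.++-assoc p [ x k ] s) (LP.++-assoc p [ x k ] (y j ∷ s)) (indel (insY (p ++ [ x k ]) s j))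

  -- A y-insertion below a good word is never a cover: the y can first be inserted after the x
  -- that follows it, and then swapped into place.
  good⇒¬indelCover : ∀ {u w} → Good u → IsShuffle u → LowerCover u w → Indel w u → ⊥
  good⇒¬indelCover (allX , _) _ (sw , _) (delX p s i) = ∉-delete p (proj₁ sw) (allX i)
  good⇒¬indelCover (_ , paired) su (sw , _ , nothing-between) (insY p s j) with Paired-next p paired
  ... | k , s' , refl =
    nothing-between (p ++ x k ∷ y j ∷ s') zs (step⇒<B swapRank swapRank-step (insY-after-x p s' k j sw zs))
      (step⇒<B swapRank swapRank-step (zs , su , swap p s' k j))
    where zs = IsShuffle-swap p s' su (λ ()) tt

  good⇒lowerCover⇔swapDown : ∀ {u} → Good u → IsShuffle u → ∀ w → (w ∈ swapDowns u) ⇔ LowerCover u w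
  good⇒lowerCover⇔swapDown {u} good su w = mk⇔ swapDown⇒cover cover⇒swapDown
    where
    swapDown⇒cover : w ∈ swapDowns u → LowerCover u w
    swapDown⇒cover w∈ with swapDowns-∈ u w w∈
    ... | p , s , i , j , refl , refl = step⇒lowerCover swapRank swapRank-step
      (IsShuffle-swap p s su (λ ()) tt , su , swap p s i j) (swapRank-swap p s i j)
    cover⇒swapDown : LowerCover u w → w ∈ swapDowns u
    cover⇒swapDown cover with lowerCover⇒step cover
    ... | _ , _ , indel ind      = ⊥-elim (good⇒¬indelCover good su cover ind)
    ... | _ , _ , swap p s i j = ∈-swapDowns p s i j

  Prec-x-trans : ∀ {i k : Fin m} → i F.< k → ∀ (c : Letter m n) → Prec (x k) c → Prec (x i) c
  Prec-x-trans i<k (x _) k≺c c<i = k≺c (<-trans c<i i<k)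
  Prec-x-trans i<k (y _) _       = tt

  StartsAbove : Fin m → Word m n → Set
  StartsAbove i s = s ≡ [] ⊎ ∃ λ k → ∃ λ s' → s ≡ x k ∷ s' × i F.< k

  record InsertionPoint (i : Fin m) (u : Word m n) : Set where
    constructor split
    field
      before after : Word m n
      u≡           : u ≡ before ++ after
      precedes     : All (λ c → Prec c (x i)) before
      follows      : All (Prec (x i)) after
      startsAbove  : StartsAbove i after

  insertionPoint : ∀ i u → AllPairs Prec u → InsertionPoint i u
  insertionPoint i []        _ = split [] [] refl [] [] (inj₁ refl)
  insertionPoint i (x k ∷ u) (k≺u ∷ ordered) with i FP.<? k
  ... | yes i<k = split [] (x k ∷ u) refl []
                    ((λ k<i → <-asym k<i i<k) ∷ All.map (λ {c} → Prec-x-trans i<k c) k≺u)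
                    (inj₂ (k , u , refl , i<k))
  ... | no ¬i<k with insertionPoint i u ordered
  ...   | split p s refl pre fol abv = split (x k ∷ p) s refl (¬i<k ∷ pre) fol abv
  insertionPoint i (y j ∷ u) (_ ∷ ordered) with insertionPoint i u ordered
  ... | split p s refl pre fol abv = split (y j ∷ p) s refl (tt ∷ pre) fol abv

  yFirstAbove-insX : ∀ i s → StartsAbove i s → ∀ i' j → yFirstAbove i' j s ⊑ yFirstAbove i' j (x i ∷ s)
  yFirstAbove-insX i s abv i' j with F.toℕ i' ≤ᵇ F.toℕ i in i'≤i
  ... | false = ≤-refl
  yFirstAbove-insX i s (inj₁ refl) i' j | true = ≤-refl
  yFirstAbove-insX i s (inj₂ (k , s' , refl , i<k)) i' j | true
    rewrite ≤ᵇ-true {F.toℕ i'} {F.toℕ k} (≤-trans (≤ᵇ-true⇒≤ i'≤i) (<⇒≤ i<k)) = ≤-refl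

  missingX⇒indelCover : ∀ u i → IsShuffle u → x i ∉ u → ∃ λ w → IndelLowerCover u w
  missingX⇒indelCover u i (distinct , ordered) xi∉u with insertionPoint i u ordered
  ... | split p s refl pre fol abv =
    p ++ x i ∷ s , step⇒lowerCover indelRank indelRank-step st (+-mono-≤ base≤ pairs≤) , delX p s i
    where
    other-letters : All (_≢ x i) (p ++ s) × All (x i ≢_) (p ++ s)
    other-letters = All.tabulate (λ c∈ c≡xi → xi∉u (subst (_∈ p ++ s) c≡xi c∈))
                  , All.tabulate (λ c∈ xi≡c → xi∉u (subst (_∈ p ++ s) (sym xi≡c) c∈))
    st : Step (p ++ x i ∷ s) (p ++ s)
    st = ( AllPairs-insert p distinct (AllP.++⁻ˡ p (proj₁ other-letters)) (AllP.++⁻ʳ p (proj₂ other-letters))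
         , AllPairs-insert p ordered pre fol )
       , (distinct , ordered) , indel (delX p s i)
    lacksX-insX : ∀ i' → i' ≢ i → lacksX i' s ⊑ lacksX i' (x i ∷ s)
    lacksX-insX i' i'≢i with i' FP.≟ i
    ... | yes i'≡i = ⊥-elim (i'≢i i'≡i)
    ... | no _     = ≤-refl
    base≤ : base (p ++ s) ≤ suc (base (p ++ x i ∷ s))
    base≤ = ≤-trans
      (+-mono-≤ (∑-mono (λ j → verdict-++-mono (onY j) false p ≤-refl))
                (∑-≤-suc i (λ i' i'≢i → verdict-++-mono (onX i') true p (lacksX-insX i' i'≢i))
                           (≤-trans (bit≤1 _) (s≤s z≤n))))
      (≤-reflexive (+-suc _ _))
    pairs≤ : pairCount yFirstAbove (p ++ s) ≤ pairCount yFirstAbove (p ++ x i ∷ s)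
    pairs≤ = pairCount-mono yFirstAbove (p ++ s) (p ++ x i ∷ s)
               (λ i' j → verdict-++-mono (onAbove i' j) false p (yFirstAbove-insX i s abv i' j))

  hasY-delY : ∀ j j' s → j ≢ j' → hasY j (y j' ∷ s) ⊑ hasY j s
  hasY-delY j j' s j≢j' with j FP.≟ j'
  ... | yes j≡j' = ⊥-elim (j≢j' j≡j')
  ... | no _     = ≤-refl

  base-delY : ∀ p s j → base (p ++ y j ∷ s) ≤ suc (base (p ++ s))
  base-delY p s j = +-mono-≤
    (∑-≤-suc j (λ j' j'≢j → verdict-++-mono (onY j') false p (hasY-delY j' j s j'≢j))
               (≤-trans (bit≤1 _) (s≤s z≤n)))
    (∑-mono (λ i → verdict-++-mono (onX i) true p ≤-refl))

  insY-step : ∀ (p s : Word m n) j → IsShuffle (p ++ y j ∷ s) → Step (p ++ s) (p ++ y j ∷ s)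
  insY-step p s j su = IsShuffle-delete p s su , su , indel (insY p s j)

  yy⇒indelCover : ∀ p s j k → IsShuffle (p ++ y j ∷ y k ∷ s) →
                  ∃ λ w → IndelLowerCover (p ++ y j ∷ y k ∷ s) w
  yy⇒indelCover p s j k su@(_ , ordered) =
    p ++ y k ∷ s
    , step⇒lowerCover indelRank indelRank-step (insY-step p (y k ∷ s) j su)
        (+-mono-≤ (base-delY p (y k ∷ s) j) pairs≤)
    , insY p (y k ∷ s) j
    where
    j≤k : F.toℕ j ≤ F.toℕ k
    j≤k = ≮⇒≥ (AllPairs-adjacent p ordered)
    yFirstAbove-delY : ∀ i' j' → yFirstAbove i' j' (y j ∷ y k ∷ s) ⊑ yFirstAbove i' j' (y k ∷ s)
    yFirstAbove-delY i' j' with F.toℕ j' ≤ᵇ F.toℕ j in j'≤j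
    ... | false = ≤-refl
    ... | true rewrite ≤ᵇ-true {F.toℕ j'} {F.toℕ k} (≤-trans (≤ᵇ-true⇒≤ j'≤j) j≤k) = ≤-refl
    pairs≤ : pairCount yFirstAbove (p ++ y j ∷ y k ∷ s) ≤ pairCount yFirstAbove (p ++ y k ∷ s)
    pairs≤ = pairCount-mono yFirstAbove (p ++ y j ∷ y k ∷ s) (p ++ y k ∷ s)
               (λ i' j' → verdict-++-mono (onAbove i' j') false p (yFirstAbove-delY i' j'))

  -- Once every x occurs before the final y, the letter x_i already decides yFirstAbove i _.
  endsWithY⇒indelCover : ∀ p j → IsShuffle (p ++ y j ∷ []) → HasAllX (p ++ y j ∷ []) →
                         ∃ λ w → IndelLowerCover (p ++ y j ∷ []) w
  endsWithY⇒indelCover p j su allX =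
    p ++ []
    , step⇒lowerCover indelRank indelRank-step (insY-step p [] j su) (+-mono-≤ (base-delY p [] j) pairs≤)
    , insY p [] j
    where
    xi∈p : ∀ i → x i ∈ p
    xi∈p i with ∈-++⁻ p (allX i)
    ... | inj₁ xi∈p        = xi∈p
    ... | inj₂ (here ())
    ... | inj₂ (there ())
    onAbove-self : ∀ i j' → onAbove i j' (x i) ≡ just false
    onAbove-self i j' rewrite ≤ᵇ-true (≤-refl {F.toℕ i}) = refl
    pairs≤ : pairCount yFirstAbove (p ++ y j ∷ []) ≤ pairCount yFirstAbove (p ++ [])
    pairs≤ = pairCount-mono yFirstAbove (p ++ y j ∷ []) (p ++ [])
      (λ i j' → ≤-reflexive (cong bit
        (verdict-++-decided (onAbove i j') false p (y j ∷ []) [] (xi∈p i) (onAbove-self i j'))))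

  ¬good⇒indelCover : ∀ u → IsShuffle u → ¬ Good u → ∃ λ w → IndelLowerCover u w
  ¬good⇒indelCover u su ¬good with FP.all? (λ i → x i ∈? u)
  ... | no ¬allX with FP.¬∀⟶∃¬ m (λ i → x i ∈ u) (λ i → x i ∈? u) ¬allX
  ...   | i , xi∉u = missingX⇒indelCover u i su xi∉u
  ¬good⇒indelCover u su ¬good | yes allX with paired-or-unpaired u
  ... | inj₁ paired          = ⊥-elim (¬good (allX , paired))
  ... | inj₂ (endsWithY p j) = endsWithY⇒indelCover p j su allX
  ... | inj₂ (yy p j k s)    = yy⇒indelCover p s j k su

-- The weighted enumeration of good words

sum-map-*ˡ : ∀ {A : Set} c (f : A → ℕ) L → sum (map (λ a → c * f a) L) ≡ c * sum (map f L)
sum-map-*ˡ c f []      = sym (*-zeroʳ c)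
sum-map-*ˡ c f (a ∷ L) rewrite sum-map-*ˡ c f L = sym (*-distribˡ-+ c (f a) (sum (map f L)))

goodWeight pickWeight : ℕ → ℕ → ℕ → ℕ
goodWeight Q zero    b       = 1
goodWeight Q (suc a) b       = goodWeight Q a b + pickWeight Q a b
pickWeight Q a       zero    = 0
pickWeight Q a       (suc b) = Q * goodWeight Q a b + pickWeight Q a b

goodWeight-zeroʳ : ∀ Q a → goodWeight Q a 0 ≡ 1
goodWeight-zeroʳ Q zero    = refl
goodWeight-zeroʳ Q (suc a) = trans (+-identityʳ _) (goodWeight-zeroʳ Q a)

goodWeight≡delannoy : ∀ q a b → goodWeight (suc q) a b ≡ delannoy q a b
goodWeight≡delannoy q zero    b       = refl
goodWeight≡delannoy q (suc a) zero    = trans (+-identityʳ _) (goodWeight-zeroʳ (suc q) a)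
goodWeight≡delannoy q (suc a) (suc b) = begin
  W a (suc b) + (suc q * W a b + P a b)   ≡⟨ regroup q (W a (suc b)) (W a b) (P a b) ⟩
  W a (suc b) + (W a b + P a b) + q * W a b
    ≡⟨ cong₂ (λ u v → u + v + q * W a b) (goodWeight≡delannoy q a (suc b)) (goodWeight≡delannoy q (suc a) b) ⟩
  delannoy q a (suc b) + delannoy q (suc a) b + q * W a b
    ≡⟨ cong (λ u → delannoy q a (suc b) + delannoy q (suc a) b + q * u) (goodWeight≡delannoy q a b) ⟩
  delannoy q a (suc b) + delannoy q (suc a) b + q * delannoy q a b ∎
  where
  open ≡-Reasoning
  W = goodWeight (suc q)
  P = pickWeight (suc q)
  regroup : ∀ q A B C → A + (suc q * B + C) ≡ A + (B + C) + q * B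
  regroup = solve-∀

module _ {m n : ℕ} where

  weight : ℕ → List (Word m n) → ℕ
  weight Q L = sum (map (λ u → Q ^ numY u) L)

  weight-++ : ∀ Q (L L' : List (Word m n)) → weight Q (L ++ L') ≡ weight Q L + weight Q L'
  weight-++ Q L L' = trans (cong sum (LP.map-++ (λ u → Q ^ numY u) L L')) (sum-++ (map _ L) _)

  weight-x∷ : ∀ Q i (L : List (Word m n)) → weight Q (map (x i ∷_) L) ≡ weight Q L
  weight-x∷ Q i L = cong sum (sym (LP.map-∘ L))

  weight-yx∷ : ∀ Q j i (L : List (Word m n)) → weight Q (map (λ t → y j ∷ x i ∷ t) L) ≡ Q * weight Q L
  weight-yx∷ Q j i L = trans (cong sum (sym (LP.map-∘ L))) (sum-map-*ˡ Q (λ u → Q ^ numY u) L)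

  pickY : Fin m → (List (Fin n) → List (Word m n)) → List (Fin n) → List (Word m n)
  pickY i words []       = []
  pickY i words (j ∷ js) = map (λ t → y j ∷ x i ∷ t) (words js) ++ pickY i words js

  pairedWords : List (Fin m) → List (Fin n) → List (Word m n)
  pairedWords []       ys = [] ∷ []
  pairedWords (i ∷ xs) ys = map (x i ∷_) (pairedWords xs ys) ++ pickY i (pairedWords xs) ys

  weight-pairedWords : ∀ Q xs ys → weight Q (pairedWords xs ys) ≡ goodWeight Q (length xs) (length ys)
  weight-pairedWords Q []       ys = refl
  weight-pairedWords Q (i ∷ xs) ys =
    trans (weight-++ Q (map (x i ∷_) (pairedWords xs ys)) (pickY i (pairedWords xs) ys))
      (cong₂ _+_ (trans (weight-x∷ Q i (pairedWords xs ys)) (weight-pairedWords Q xs ys)) (weight-pickY ys))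
    where
    weight-pickY : ∀ ys → weight Q (pickY i (pairedWords xs) ys) ≡ pickWeight Q (length xs) (length ys)
    weight-pickY []       = refl
    weight-pickY (j ∷ js) =
      trans (weight-++ Q (map (λ t → y j ∷ x i ∷ t) (pairedWords xs js)) (pickY i (pairedWords xs) js))
        (cong₂ _+_ (trans (weight-yx∷ Q j i (pairedWords xs js)) (cong (Q *_) (weight-pairedWords Q xs js)))
                   (weight-pickY js))

  pairedWords-sound : ∀ xs ys u → u ∈ pairedWords xs ys → Paired u × xsOf u ≡ xs × ysOf u ⊆ ys
  pairedWords-sound []       ys .[] (here refl) = [] , refl , []⊆-universal ys
  pairedWords-sound (i ∷ xs) ys u u∈ with ∈-++⁻ (map (x i ∷_) (pairedWords xs ys)) u∈
  ... | inj₁ u∈x∷ with ∈-map⁻ (x i ∷_) u∈x∷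
  ...   | t , t∈ , refl with pairedWords-sound xs ys t t∈
  ...     | paired , xs≡ , ys⊆ = x∷ paired , cong (i ∷_) xs≡ , ys⊆
  pairedWords-sound (i ∷ xs) ys u u∈ | inj₂ u∈pick = picked ys u∈pick
    where
    picked : ∀ ys → u ∈ pickY i (pairedWords xs) ys → Paired u × xsOf u ≡ i ∷ xs × ysOf u ⊆ ys
    picked (j ∷ js) u∈ with ∈-++⁻ (map (λ t → y j ∷ x i ∷ t) (pairedWords xs js)) u∈
    ... | inj₁ u∈yx∷ with ∈-map⁻ (λ t → y j ∷ x i ∷ t) u∈yx∷
    ...   | t , t∈ , refl with pairedWords-sound xs js t t∈
    ...     | paired , xs≡ , ys⊆ = yx∷ paired , cong (i ∷_) xs≡ , refl ∷ ys⊆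
    picked (j ∷ js) u∈ | inj₂ u∈pick with picked js u∈pick
    ... | paired , xs≡ , ys⊆ = paired , xs≡ , j ∷ʳ ys⊆

  pairedWords-complete : ∀ {u} ys → Paired u → ysOf u ⊆ ys → u ∈ pairedWords (xsOf u) ys
  pairedWords-complete ys []                      _   = here refl
  pairedWords-complete {x i ∷ t} ys (x∷ paired) ys⊆ =
    ∈-++⁺ˡ (∈-map⁺ (x i ∷_) (pairedWords-complete ys paired ys⊆))
  pairedWords-complete {y j ∷ x i ∷ t} ys (yx∷ paired) ys⊆ =
    ∈-++⁺ʳ (map (x i ∷_) (pairedWords (xsOf t) ys)) (picked ys ys⊆)
    where
    picked : ∀ ys → j ∷ ysOf t ⊆ ys → y j ∷ x i ∷ t ∈ pickY i (pairedWords (xsOf t)) ys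
    picked (b ∷ ys) (.b ∷ʳ ys⊆) =
      ∈-++⁺ʳ (map (λ t → y b ∷ x i ∷ t) (pairedWords (xsOf t) ys)) (picked ys ys⊆)
    picked (j ∷ ys) (refl ∷ ys⊆) =
      ∈-++⁺ˡ (∈-map⁺ (λ t → y j ∷ x i ∷ t) (pairedWords-complete ys paired ys⊆))

  pickY-head : ∀ i words ys v → v ∈ pickY i words ys → ∃ λ j → ∃ λ t → v ≡ y j ∷ x i ∷ t × j ∈ ys
  pickY-head i words (j ∷ js) v v∈ with ∈-++⁻ (map (λ t → y j ∷ x i ∷ t) (words js)) v∈
  ... | inj₁ v∈yx∷ with ∈-map⁻ (λ t → y j ∷ x i ∷ t) v∈yx∷
  ...   | t , _ , refl = j , t , refl , here refl
  pickY-head i words (j ∷ js) v v∈ | inj₂ v∈pick with pickY-head i words js v v∈pick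
  ... | j' , t , refl , j'∈ = j' , t , refl , there j'∈

  pairedWords-unique : ∀ xs ys → Unique ys → Unique (pairedWords xs ys)
  pairedWords-unique []       ys _         = [] ∷ []
  pairedWords-unique (i ∷ xs) ys unique-ys =
    UP.++⁺ (UP.map⁺ LP.∷-injectiveʳ (pairedWords-unique xs ys unique-ys)) (pickY-unique ys unique-ys) x∷-disjoint
    where
    pickY-unique : ∀ ys → Unique ys → Unique (pickY i (pairedWords xs) ys)
    pickY-unique []       _                = []
    pickY-unique (j ∷ js) (j∉js ∷ unique) =
      UP.++⁺ (UP.map⁺ (LP.∷-injectiveʳ ∘ LP.∷-injectiveʳ) (pairedWords-unique xs js unique))
             (pickY-unique js unique) yj-disjoint
      where
      yj-disjoint : ∀ {v} → ¬ (v ∈ map (λ t → y j ∷ x i ∷ t) (pairedWords xs js) ×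
                               v ∈ pickY i (pairedWords xs) js)
      yj-disjoint (v∈ , v∈pick)
        with ∈-map⁻ (λ t → y j ∷ x i ∷ t) v∈ | pickY-head i (pairedWords xs) js _ v∈pick
      ... | t , _ , refl | j' , t' , refl , j∈js = All.lookup j∉js j∈js refl
    x∷-disjoint : ∀ {v} → ¬ (v ∈ map (x i ∷_) (pairedWords xs ys) × v ∈ pickY i (pairedWords xs) ys)
    x∷-disjoint (v∈ , v∈pick) with ∈-map⁻ (x i ∷_) v∈ | pickY-head i (pairedWords xs) ys _ v∈pick
    ... | t , _ , refl | _ , _ , () , _

length-allFin : ∀ k → length (allFin k) ≡ k
length-allFin k = LP.length-tabulate (λ i → i)

Sorted : ∀ {k} → List (Fin k) → Set
Sorted = AllPairs F._<_

allFin-sorted : ∀ k → Sorted (allFin k)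
allFin-sorted k = APP.tabulate⁺-< (λ i<j → i<j)

module _ {k : ℕ} where

  drop-smallest : ∀ {a b : Fin k} {l bs} → All (a F.<_) l → a ≡ b → (∀ {c} → c ∈ l → c ∈ b ∷ bs) →
                  ∀ {c} → c ∈ l → c ∈ bs
  drop-smallest a<l refl l⊆ c∈ with l⊆ c∈
  ... | here refl = ⊥-elim (<-irrefl refl (All.lookup a<l c∈))
  ... | there c∈bs = c∈bs

  sorted-⊆ : ∀ (l ys : List (Fin k)) → Sorted l → Sorted ys → (∀ {a} → a ∈ l → a ∈ ys) → l ⊆ ys
  sorted-⊆ []       ys       _          _          _   = []⊆-universal ys
  sorted-⊆ (a ∷ as) []       _          _          l⊆ with l⊆ (here refl)
  ... | ()
  sorted-⊆ (a ∷ as) (b ∷ bs) (a<as ∷ sa) (b<bs ∷ sb) l⊆ with a FP.≟ b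
  ... | yes refl = refl ∷ sorted-⊆ as bs sa sb (drop-smallest a<as refl (l⊆ ∘ there))
  ... | no a≢b   = b ∷ʳ sorted-⊆ (a ∷ as) bs (a<as ∷ sa) sb l⊆bs
    where
    a∈bs : a ∈ bs
    a∈bs with l⊆ (here refl)
    ... | here a≡b  = ⊥-elim (a≢b a≡b)
    ... | there a∈ = a∈
    l⊆bs : ∀ {c} → c ∈ a ∷ as → c ∈ bs
    l⊆bs (here refl) = a∈bs
    l⊆bs (there c∈) with l⊆ (there c∈)
    ... | here refl = ⊥-elim (<-asym (All.lookup b<bs a∈bs) (All.lookup a<as c∈))
    ... | there c∈bs = c∈bs

  sorted-≡ : ∀ (l ys : List (Fin k)) → Sorted l → Sorted ys →
             (∀ {a} → a ∈ l → a ∈ ys) → (∀ {a} → a ∈ ys → a ∈ l) → l ≡ ys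
  sorted-≡ []       []       _           _           _  _  = refl
  sorted-≡ []       (b ∷ bs) _           _           _  ys⊆ with ys⊆ (here refl)
  ... | ()
  sorted-≡ (a ∷ as) []       _           _           l⊆ _  with l⊆ (here refl)
  ... | ()
  sorted-≡ (a ∷ as) (b ∷ bs) (a<as ∷ sa) (b<bs ∷ sb) l⊆ ys⊆ with a FP.≟ b
  ... | yes refl = cong (a ∷_) (sorted-≡ as bs sa sb (drop-smallest a<as refl (l⊆ ∘ there))
                                                     (drop-smallest b<bs refl (ys⊆ ∘ there)))
  ... | no a≢b with l⊆ (here refl) | ys⊆ (here refl)
  ...   | here a≡b   | _          = ⊥-elim (a≢b a≡b)
  ...   | _          | here b≡a   = ⊥-elim (a≢b (sym b≡a))
  ...   | there a∈bs | there b∈as = ⊥-elim (<-asym (All.lookup b<bs a∈bs) (All.lookup a<as b∈as))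

module _ {m n : ℕ} where

  x-later : ∀ i (t : Word m n) → All (x i ≢_) t → All (Prec (x i)) t → All (i F.<_) (xsOf t)
  x-later i []        _              _            = []
  x-later i (x k ∷ t) (xi≢xk ∷ ≢t)   (i≯k ∷ ≺t)  = FP.≤∧≢⇒< (≮⇒≥ i≯k) (xi≢xk ∘ cong x) ∷ x-later i t ≢t ≺t
  x-later i (y _ ∷ t) (_ ∷ ≢t)       (_ ∷ ≺t)     = x-later i t ≢t ≺t

  y-later : ∀ j (t : Word m n) → All (y j ≢_) t → All (Prec (y j)) t → All (j F.<_) (ysOf t)
  y-later j []        _              _            = []
  y-later j (y k ∷ t) (yj≢yk ∷ ≢t)   (j≯k ∷ ≺t)  = FP.≤∧≢⇒< (≮⇒≥ j≯k) (yj≢yk ∘ cong y) ∷ y-later j t ≢t ≺t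
  y-later j (x _ ∷ t) (_ ∷ ≢t)       (_ ∷ ≺t)     = y-later j t ≢t ≺t

  IsShuffle⇒sorted : ∀ (u : Word m n) → IsShuffle u → Sorted (xsOf u) × Sorted (ysOf u)
  IsShuffle⇒sorted []        _                    = [] , []
  IsShuffle⇒sorted (x i ∷ t) (≢t ∷ distinct , ≺t ∷ ordered) with IsShuffle⇒sorted t (distinct , ordered)
  ... | sx , sy = x-later i t ≢t ≺t ∷ sx , sy
  IsShuffle⇒sorted (y j ∷ t) (≢t ∷ distinct , ≺t ∷ ordered) with IsShuffle⇒sorted t (distinct , ordered)
  ... | sx , sy = sx , y-later j t ≢t ≺t ∷ sy

  x-earlier : ∀ i (t : Word m n) → All (i F.<_) (xsOf t) → All (x i ≢_) t × All (Prec (x i)) t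
  x-earlier i []        _           = [] , []
  x-earlier i (x k ∷ t) (i<k ∷ i<t) with x-earlier i t i<t
  ... | ≢t , ≺t = (λ { refl → <-irrefl refl i<k }) ∷ ≢t , (λ k<i → <-asym k<i i<k) ∷ ≺t
  x-earlier i (y k ∷ t) i<t with x-earlier i t i<t
  ... | ≢t , ≺t = (λ ()) ∷ ≢t , tt ∷ ≺t

  y-earlier : ∀ j (t : Word m n) → All (j F.<_) (ysOf t) → All (y j ≢_) t × All (Prec (y j)) t
  y-earlier j []        _           = [] , []
  y-earlier j (y k ∷ t) (j<k ∷ j<t) with y-earlier j t j<t
  ... | ≢t , ≺t = (λ { refl → <-irrefl refl j<k }) ∷ ≢t , (λ k<j → <-asym k<j j<k) ∷ ≺t
  y-earlier j (x k ∷ t) j<t with y-earlier j t j<t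
  ... | ≢t , ≺t = (λ ()) ∷ ≢t , tt ∷ ≺t

  sorted⇒IsShuffle : ∀ (u : Word m n) → Sorted (xsOf u) → Sorted (ysOf u) → IsShuffle u
  sorted⇒IsShuffle []        _           _           = [] , []
  sorted⇒IsShuffle (x i ∷ t) (i<t ∷ sx) sy          with sorted⇒IsShuffle t sx sy | x-earlier i t i<t
  ... | distinct , ordered | ≢t , ≺t = ≢t ∷ distinct , ≺t ∷ ordered
  sorted⇒IsShuffle (y j ∷ t) sx          (j<t ∷ sy) with sorted⇒IsShuffle t sx sy | y-earlier j t j<t
  ... | distinct , ordered | ≢t , ≺t = ≢t ∷ distinct , ≺t ∷ ordered

  ∈xsOf⇒x∈ : ∀ (u : Word m n) i → i ∈ xsOf u → x i ∈ u
  ∈xsOf⇒x∈ (x k ∷ u) i (here refl) = here refl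
  ∈xsOf⇒x∈ (x k ∷ u) i (there i∈) = there (∈xsOf⇒x∈ u i i∈)
  ∈xsOf⇒x∈ (y k ∷ u) i i∈         = there (∈xsOf⇒x∈ u i i∈)

  x∈⇒∈xsOf : ∀ (u : Word m n) i → x i ∈ u → i ∈ xsOf u
  x∈⇒∈xsOf (x k ∷ u) i (here refl) = here refl
  x∈⇒∈xsOf (x k ∷ u) i (there xi∈) = there (x∈⇒∈xsOf u i xi∈)
  x∈⇒∈xsOf (y k ∷ u) i (there xi∈) = x∈⇒∈xsOf u i xi∈

  length-xsOf-ysOf : ∀ (u : Word m n) → length u ≡ length (xsOf u) + length (ysOf u)
  length-xsOf-ysOf []        = refl
  length-xsOf-ysOf (x i ∷ u) = cong suc (length-xsOf-ysOf u)
  length-xsOf-ysOf (y j ∷ u) = trans (cong suc (length-xsOf-ysOf u)) (sym (+-suc _ _))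

  goodWords : List (Word m n)
  goodWords = pairedWords (allFin m) (allFin n)

  ∈goodWords⇒ : ∀ u → u ∈ goodWords → IsShuffle u × Good u × length u ≤ m + n
  ∈goodWords⇒ u u∈ with pairedWords-sound (allFin m) (allFin n) u u∈
  ... | paired , xs≡ , ys⊆ =
      sorted⇒IsShuffle u (subst Sorted (sym xs≡) (allFin-sorted m)) (AllPairs-resp-⊆ ys⊆ (allFin-sorted n))
    , ((λ i → ∈xsOf⇒x∈ u i (subst (i ∈_) (sym xs≡) (∈-allFin i))) , paired)
    , subst (_≤ m + n) (sym (length-xsOf-ysOf u))
        (+-mono-≤ (≤-reflexive (trans (cong length xs≡) (length-allFin m)))
                  (subst (length (ysOf u) ≤_) (length-allFin n) (length-mono-≤ ys⊆)))
    where
    AllPairs-resp-⊆ : ∀ {l l'} → l ⊆ l' → Sorted l' → Sorted l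
    AllPairs-resp-⊆ []           []                = []
    AllPairs-resp-⊆ (_ ∷ʳ l⊆)    (_ ∷ sorted)       = AllPairs-resp-⊆ l⊆ sorted
    AllPairs-resp-⊆ (refl ∷ l⊆)  (a<l' ∷ sorted)    = All-resp-⊆ l⊆ a<l' ∷ AllPairs-resp-⊆ l⊆ sorted

  goodWords-complete : ∀ u → IsShuffle u → Good u → u ∈ goodWords
  goodWords-complete u su (allX , paired) with IsShuffle⇒sorted u su
  ... | sx , sy = subst (λ l → u ∈ pairedWords l (allFin n)) xs≡
                        (pairedWords-complete (allFin n) paired
                          (sorted-⊆ (ysOf u) (allFin n) sy (allFin-sorted n) (λ _ → ∈-allFin _)))
    where
    xs≡ : xsOf u ≡ allFin m
    xs≡ = sorted-≡ (xsOf u) (allFin m) sx (allFin-sorted m)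
                   (λ _ → ∈-allFin _) (λ {i} _ → x∈⇒∈xsOf u i (allX i))

  goodWords-unique : Unique goodWords
  goodWords-unique = pairedWords-unique (allFin m) (allFin n) (UP.allFin⁺ n)

  weight-goodWords : ∀ q → weight (suc q) goodWords ≡ binomSum m n (suc q)
  weight-goodWords q = begin
    weight (suc q) goodWords          ≡⟨ weight-pairedWords (suc q) (allFin m) (allFin n) ⟩
    goodWeight (suc q) (length (allFin m)) (length (allFin n))
      ≡⟨ cong₂ (goodWeight (suc q)) (length-allFin m) (length-allFin n) ⟩
    goodWeight (suc q) m n            ≡⟨ goodWeight≡delannoy q m n ⟩
    delannoy q m n                    ≡⟨ delannoy≡binomSum q m n ⟩
    binomSum m n (suc q)              ∎
    where open ≡-Reasoning

  allLetters-complete : ∀ (a : Letter m n) → a ∈ allLetters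
  allLetters-complete (x i) = ∈-++⁺ˡ (∈-map⁺ x (∈-allFin i))
  allLetters-complete (y j) = ∈-++⁺ʳ (map x (allFin m)) (∈-map⁺ y (∈-allFin j))

  allLetters-unique : Unique (allLetters {m} {n})
  allLetters-unique =
    UP.++⁺ (UP.map⁺ (λ { refl → refl }) (UP.allFin⁺ m)) (UP.map⁺ (λ { refl → refl }) (UP.allFin⁺ n)) x≢y
    where
    x≢y : ∀ {v} → ¬ (v ∈ map x (allFin m) × v ∈ map y (allFin n))
    x≢y (v∈x , v∈y) with ∈-map⁻ x v∈x | ∈-map⁻ y v∈y
    ... | _ , _ , refl | _ , _ , ()

  ∈wordsOfLength : ∀ (u : Word m n) → u ∈ wordsOfLength (length u)
  ∈wordsOfLength []      = here refl
  ∈wordsOfLength (a ∷ t) = ∈-concat⁺′ (∈-map⁺ (a ∷_) (∈wordsOfLength t))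
    (∈-map⁺ (λ b → map (b ∷_) (wordsOfLength (length t))) (allLetters-complete a))

  wordsOfLength-length : ∀ k (v : Word m n) → v ∈ wordsOfLength k → length v ≡ k
  wordsOfLength-length zero    v (here refl) = refl
  wordsOfLength-length (suc k) v v∈ with ∈-concat⁻′ (map (λ b → map (b ∷_) (wordsOfLength k)) allLetters) v∈
  ... | vs , v∈vs , vs∈ with ∈-map⁻ (λ b → map (b ∷_) (wordsOfLength k)) vs∈
  ...   | a , _ , refl with ∈-map⁻ (a ∷_) v∈vs
  ...     | t , t∈ , refl = cong suc (wordsOfLength-length k t t∈)

  wordsOfLength-unique : ∀ k → Unique (wordsOfLength {m} {n} k)
  wordsOfLength-unique zero    = [] ∷ []
  wordsOfLength-unique (suc k) =
    UP.concat⁺ {xss = map (λ b → map (b ∷_) (wordsOfLength k)) allLetters}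
      (AllP.map⁺ (All.tabulate (λ _ → UP.map⁺ LP.∷-injectiveʳ (wordsOfLength-unique k))))
      (APP.map⁺ (AllPairs.map different-heads allLetters-unique))
    where
    different-heads : ∀ {a b : Letter m n} → a ≢ b →
                      ∀ {v} → ¬ (v ∈ map (a ∷_) (wordsOfLength k) × v ∈ map (b ∷_) (wordsOfLength k))
    different-heads a≢b (v∈a , v∈b) with ∈-map⁻ _ v∈a | ∈-map⁻ _ v∈b
    ... | _ , _ , refl | _ , _ , a∷≡b∷ = a≢b (LP.∷-injectiveˡ a∷≡b∷)

  shuffleWords-unique : Unique (shuffleWords m n)
  shuffleWords-unique = UP.filter⁺ isShuffle?
    (UP.concat⁺ {xss = map (wordsOfLength {m} {n}) (upTo (suc (m + n)))}
      (AllP.map⁺ {xs = upTo (suc (m + n))} {f = wordsOfLength} (All.tabulate (λ {k} _ → wordsOfLength-unique k)))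
      (APP.map⁺ {f = wordsOfLength} {xs = upTo (suc (m + n))}
        (AllPairs.map different-lengths (UP.upTo⁺ (suc (m + n))))))
    where
    different-lengths : ∀ {a b : ℕ} → a ≢ b → ∀ {v} → ¬ (v ∈ wordsOfLength {m} {n} a × v ∈ wordsOfLength b)
    different-lengths a≢b (v∈a , v∈b) =
      a≢b (trans (sym (wordsOfLength-length _ _ v∈a)) (wordsOfLength-length _ _ v∈b))

  ∈shuffleWords : ∀ (u : Word m n) → IsShuffle u → length u ≤ m + n → u ∈ shuffleWords m n
  ∈shuffleWords u su u≤ =
    ∈-filter⁺ isShuffle? (∈-concat⁺′ (∈wordsOfLength u) (∈-map⁺ wordsOfLength (∈-upTo⁺ (s≤s u≤)))) su

  shuffleWords⇒IsShuffle : ∀ (u : Word m n) → u ∈ shuffleWords m n → IsShuffle u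
  shuffleWords⇒IsShuffle u u∈ = proj₂ (∈-filter⁻ isShuffle? {xs = concatMap wordsOfLength (upTo (suc (m + n)))} u∈)

-- H at t = 0

sum-filter : ∀ {A : Set} {P : A → Set} (P? : Decidable P) (f : A → ℕ) L →
             (∀ a → a ∈ L → ¬ P a → f a ≡ 0) → sum (map f L) ≡ sum (map f (filter P? L))
sum-filter P? f []      _      = refl
sum-filter P? f (a ∷ L) ¬P⇒0 with P? a
... | yes _  = cong (f a +_) (sum-filter P? f L (λ b b∈ → ¬P⇒0 b (there b∈)))
... | no ¬Pa = trans (cong (_+ sum (map f L)) (¬P⇒0 a (here refl) ¬Pa))
                     (sum-filter P? f L (λ b b∈ → ¬P⇒0 b (there b∈)))

module _ {m n : ℕ} where

  CountIs-unique : ∀ {P : Word m n → Set} {k L} → CountIs P k → Unique L → (∀ w → (w ∈ L) ⇔ P w) →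
                   k ≡ length L
  CountIs-unique (L' , unique' , members' , refl) unique members = Perm.↭-length
    (∼bag⇒↭ (unique∧set⇒bag unique' unique (λ {w} →
      mk⇔ (Equivalence.from (members w) ∘ Equivalence.to (members' w))
          (Equivalence.from (members' w) ∘ Equivalence.to (members w)))))

  CountIs-empty : ∀ {P : Word m n → Set} {k} → CountIs P k → (∀ w → ¬ P w) → k ≡ 0
  CountIs-empty count ¬P = CountIs-unique count [] (λ w → mk⇔ (λ ()) (⊥-elim ∘ ¬P w))

  CountIs-inhabited : ∀ {P : Word m n → Set} {k w} → CountIs P k → P w → ∃ λ k' → k ≡ suc k'
  CountIs-inhabited (_ ∷ L , _ , _ , refl) _  = length L , refl
  CountIs-inhabited ([] , _ , members , _) Pw with Equivalence.from (members _) Pw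
  ... | ()

  good? : Decidable (Good {m} {n})
  good? u = FP.all? (λ i → x i ∈? u) ×-dec paired? u
    where
    open DecMembership {A = Letter m n} _≟L_ using (_∈?_)
    paired? : Decidable Paired
    paired? w with paired-or-unpaired w
    ... | inj₁ paired   = yes paired
    ... | inj₂ unpaired = no (Unpaired⇒¬Paired unpaired)

  goodShuffleWords↭goodWords : filter good? (shuffleWords m n) ↭ goodWords
  goodShuffleWords↭goodWords = ∼bag⇒↭
    (unique∧set⇒bag (UP.filter⁺ good? shuffleWords-unique) goodWords-unique (mk⇔ to from))
    where
    to : ∀ {u} → u ∈ filter good? (shuffleWords m n) → u ∈ goodWords
    to {u} u∈ with ∈-filter⁻ good? {xs = shuffleWords m n} u∈
    ... | u∈sw , good = goodWords-complete u (shuffleWords⇒IsShuffle u u∈sw) good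
    from : ∀ {u} → u ∈ goodWords → u ∈ filter good? (shuffleWords m n)
    from {u} u∈ with ∈goodWords⇒ u u∈
    ... | su , good , u≤ = ∈-filter⁺ good? (∈shuffleWords u su u≤) good

  module _ (q : ℕ) (inC inI : Word m n → ℕ)
           (countC : (u : Word m n) → IsShuffle u → CountIs (LowerCover u) (inC u))
           (countI : (u : Word m n) → IsShuffle u → CountIs (IndelLowerCover u) (inI u)) where

    term : Word m n → ℕ
    term u = suc q ^ inC u * 0 ^ inI u

    term-¬good : ∀ u → u ∈ shuffleWords m n → ¬ Good u → term u ≡ 0
    term-¬good u u∈ ¬good with shuffleWords⇒IsShuffle u u∈
    ... | su with ¬good⇒indelCover u su ¬good
    ...   | _ , cover with CountIs-inhabited (countI u su) cover
    ...     | _ , inI≡suc rewrite inI≡suc = *-zeroʳ (suc q ^ inC u)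

    inC-good : ∀ u → IsShuffle u → Good u → inC u ≡ numY u
    inC-good u su good@(_ , paired) =
      trans (CountIs-unique (countC u su) (swapDowns-unique u) (good⇒lowerCover⇔swapDown good su))
            (swapDowns-length paired)

    inI-good : ∀ u → IsShuffle u → Good u → inI u ≡ 0
    inI-good u su good = CountIs-empty (countI u su) (λ w (cover , w→u) → good⇒¬indelCover good su cover w→u)

    term-good : ∀ u → u ∈ goodWords → term u ≡ suc q ^ numY u
    term-good u u∈ with ∈goodWords⇒ u u∈
    ... | su , good , _ rewrite inC-good u su good | inI-good u su good = *-identityʳ _

    H-at-zero : H m n inC inI (suc q) 0 ≡ weight (suc q) (goodWords {m} {n})
    H-at-zero = begin
      sum (map term (shuffleWords m n))              ≡⟨ sum-filter good? term (shuffleWords m n) term-¬good ⟩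
      sum (map term (filter good? (shuffleWords m n))) ≡⟨ sum-↭ (Perm.map⁺ term goodShuffleWords↭goodWords) ⟩
      sum (map term goodWords)                       ≡⟨ cong sum (LP.map-cong-local (All.tabulate (term-good _))) ⟩
      weight (suc q) (goodWords {m} {n})             ∎
      where open ≡-Reasoning

proposition3p23 : (m n q : ℕ) →
    (Del q m n ↔ Fin (binomSum m n (suc q))) ×
    ((inC inI : Word m n → ℕ) →
      ((u : Word m n) → IsShuffle u → CountIs (LowerCover u) (inC u)) →
      ((u : Word m n) → IsShuffle u → CountIs (IndelLowerCover u) (inI u)) →
      H m n inC inI (suc q) 0 ≡ binomSum m n (suc q))
proposition3p23 m n q =
    Del↔binomSum q m n
  , λ inC inI countC countI → trans (H-at-zero q inC inI countC countI) (weight-goodWords {m} {n} q)
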